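{- Let $a,b\in\mathbb{Z}$, let $n,s\in\mathbb{N}$, and let $t\in\mathbb{N}$ with $t\mid n$. Consider the congruence $$a^{s}x\equiv b \pmod{n^s}$$ with the restriction $(x,n^s)_s=t^s$. This restricted congruence has a solution $x$ if and only if $t^s\mid (b,n^s)_s$ and $\left(a^{s},\frac{n^s}{t^s}\right)_s=\left(\frac{b}{t^s},\frac{n^s}{t^s}\right)_s$. When these conditions hold, let $d\in\mathbb{N}$ be defined by $d^s=\left(a^{s},\frac{n^s}{t^s}\right)_s$. Then the number of solutions $x$ modulo $n^s$ is $$d^s\prod_{\substack{p\mid d\\ p\nmid \frac{n}{dt}\\ p\text{ prime}}}(1-p^{ -s})=\frac{J_s\!\left(\frac{n}{t}\right)}{J_s\!\left(\frac{n}{dt}\right)}.$$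
   Context: For integers $a,b$, not both zero, and $s\in\mathbb{N}$, the generalized gcd $(a,b)_s$ is the largest $l^s$ (with $l\in\mathbb{N}$) dividing both $a$ and $b$; so $(a,b)_1=\gcd(a,b)$. The Jordan totient function is $J_s(m)=m^s\prod_{p\mid m}(1-p^{ -s})$, the product over primes $p$ dividing $m$. Solutions are counted as residue classes $x$ modulo $n^s$ (e.g. $1\le x\le n^s$). -}

module Defs where

open import Data.Nat as ℕ using (ℕ; zero; suc; NonZero; _^_; _*_; _+_)
open import Data.Nat.Properties using (m^n≢0; m*n≢0)
import Data.Nat.Divisibility as ℕD
open import Data.Nat.Primality using (Prime; prime?)
open import Data.Integer as ℤ using (ℤ; +_; ∣_∣)
open import Data.Integer.Divisibility using (_∣_)
open import Data.Rational as ℚ using (ℚ; 1ℚ)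
open import Data.List using (List; filter; upTo; foldr; length)
open import Data.Product using (_×_)
open import Relation.Nullary using (Dec; yes; no; ¬_)
open import Relation.Nullary.Decidable using (_×-dec_; ¬?)
open import Relation.Unary using (Pred; Decidable)
open import Level using (0ℓ)
open import Relation.Binary.PropositionalEquality using (_≡_)


-- Divisibility of integers is decidable (ℤ-divisibility is ℕ-divisibility of
-- absolute values).
_∣ℤ?_ : (i j : ℤ) → Dec (i ∣ j)
i ∣ℤ? j = ∣ i ∣ ℕD.∣? ∣ j ∣

largestUpTo : {P : Pred ℕ 0ℓ} → Decidable P → ℕ → ℕ
largestUpTo P? zero = zero
largestUpTo P? (suc k) with P? (suc k)
... | yes _ = suc k
... | no _ = largestUpTo P? k

-- For s ≥ 1 and (a,b) ≠ (0,0), any such l satisfies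
-- l ≤ l^s ≤ |a| + |b|, so searching up to |a| + |b| finds the maximum.
genGcdBase : ℕ → ℤ → ℤ → ℕ
genGcdBase s a b =
  largestUpTo (λ l → ((+ (l ^ s)) ∣ℤ? a) ×-dec ((+ (l ^ s)) ∣ℤ? b)) (∣ a ∣ + ∣ b ∣)

genGcd : ℕ → ℤ → ℤ → ℕ
genGcd s a b = genGcdBase s a b ^ s

-- The factor (1 - p^{-s}) for a prime p (p = 0 never occurs, since 0 is not prime).
factor : ℕ → ℕ → ℚ
factor s zero = 1ℚ
factor s (suc k) = 1ℚ ℚ.- (ℚ._/_ (+ 1) (suc k ^ s) {{m^n≢0 (suc k) s}})

primeProd : ℕ → {P : Pred ℕ 0ℓ} → Decidable P → ℕ → ℚ
primeProd s P? N =
  foldr (λ p acc → factor s p ℚ.* acc) 1ℚ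
        (filter (λ p → prime? p ×-dec P? p) (upTo (suc N)))

-- Jordan totient J_s(m) = m^s ∏_{p ∣ m} (1 - p^{-s}), as a rational number.
-- (Every prime divisor p of m ≥ 1 satisfies p ≤ m.)
J : ℕ → ℕ → ℚ
J s m = (+ (m ^ s) ℚ./ 1) ℚ.* primeProd s (λ p → p ℕD.∣? m) m

IsSol : (s : ℕ) (a b : ℤ) (n t : ℕ) → ℤ → Set
IsSol s a b n t x =
  ((+ (n ^ s)) ∣ ((a ℤ.^ s) ℤ.* x ℤ.- b)) × (genGcd s x (+ (n ^ s)) ≡ t ^ s)

isSol? : (s : ℕ) (a b : ℤ) (n t : ℕ) → Decidable (IsSol s a b n t)
isSol? s a b n t x =
  ((+ (n ^ s)) ∣ℤ? ((a ℤ.^ s) ℤ.* x ℤ.- b)) ×-dec (genGcd s x (+ (n ^ s)) ℕ.≟ t ^ s)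

numSol : (s : ℕ) (a b : ℤ) (n t : ℕ) → ℕ
numSol s a b n t = length (filter (λ x → isSol? s a b n t (+ x)) (upTo (n ^ s)))

module Submission where

-- Write n = t·m, T = t^s, M = m^s, N = n^s = T·M and A = a^s.  The proof has
-- three steps.
--  (1) The restriction forces T ∣ x; for x = T·y it says precisely that no prime
--      p ∣ m has p^s ∣ y ("y is s-power-coprime to m"), and after writing
--      b = b′·T the congruence becomes  A·y ≡ b′ (mod M).  Comparing the
--      generalized gcds of A and b′ with M gives the solvability conditions.
--  (2) With d = gcd(|a|, m), so that d^s = (A, M)_s, write m = d·q.  The reduced
--      congruence is a single residue class  y ≡ y₀ (mod q^s), and on this class
--      s-power-coprimality to m only concerns the primes p ∣ d with p ∤ q.
--  (3) A sieve over a residue class (one prime at a time, via the Chinese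
--      remainder theorem) counts the y < M = q^s·d^s in the class surviving those
--      primes: d^s·∏ (1 - p^{-s}).  Splitting the prime divisors of m by whether
--      they divide q turns this into J_s(n/t) / J_s(n/(d·t)).

open import Data.Nat using (ℕ; NonZero)
open import Data.Nat.Divisibility using (_∣_)
open import Data.Integer using (ℤ)

module Counting where

  open import Data.Nat using (ℕ; zero; suc; _+_; _*_; _<_; s≤s; z≤n; NonZero)
  open import Data.Nat.Properties
  open import Data.Nat.Divisibility using (_∣_; ∣m+n∣m⇒∣n; ∣⇒≤; m∣m*n)
  open import Data.List using (filter; upTo; length; [_]; _∷ʳ_; _++_)
  import Data.List.Properties as List
  open import Data.Empty using (⊥-elim)
  open import Relation.Nullary using (yes; no; ¬_)
  open import Relation.Nullary.Decidable using (_×-dec_; ¬?)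
  open import Relation.Unary using (Pred; Decidable)
  open import Level using (0ℓ)
  open import Data.Sum using (inj₁; inj₂)
  open import Relation.Binary.PropositionalEquality hiding ([_])
  open ≡-Reasoning

  count : {P : Pred ℕ 0ℓ} → Decidable P → ℕ → ℕ
  count P? zero = 0
  count P? (suc n) with P? n
  ... | yes _ = suc (count P? n)
  ... | no _ = count P? n

  length-filter-upTo : {P : Pred ℕ 0ℓ} (P? : Decidable P) (n : ℕ) →
                       length (filter P? (upTo n)) ≡ count P? n
  length-filter-upTo P? zero = refl
  length-filter-upTo P? (suc n) = begin
      length (filter P? (upTo (suc n)))                       ≡⟨ cong (λ l → length (filter P? l)) (sym (List.upTo-∷ʳ n)) ⟩
      length (filter P? (upTo n ∷ʳ n))                        ≡⟨ cong length (List.filter-++ P? (upTo n) [ n ]) ⟩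
      length (filter P? (upTo n) ++ filter P? [ n ])          ≡⟨ List.length-++ (filter P? (upTo n)) ⟩
      length (filter P? (upTo n)) + length (filter P? [ n ])  ≡⟨ cong (_+ length (filter P? [ n ])) (length-filter-upTo P? n) ⟩
      count P? n + length (filter P? [ n ])                    ≡⟨ last ⟩
      count P? (suc n)                                         ∎
    where
    last : count P? n + length (filter P? [ n ]) ≡ count P? (suc n)
    last with P? n
    ... | yes _ = +-comm _ 1
    ... | no _ = +-identityʳ _

  count-cong : {P Q : Pred ℕ 0ℓ} (P? : Decidable P) (Q? : Decidable Q) (n : ℕ) →
               (∀ y → y < n → P y → Q y) → (∀ y → y < n → Q y → P y) → count P? n ≡ count Q? n
  count-cong P? Q? zero to from = refl
  count-cong P? Q? (suc n) to from with P? n | Q? n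
  ... | yes _ | yes _ = cong suc (count-cong P? Q? n (λ y y<n → to y (m<n⇒m<1+n y<n)) (λ y y<n → from y (m<n⇒m<1+n y<n)))
  ... | yes p | no ¬q = ⊥-elim (¬q (to n ≤-refl p))
  ... | no ¬p | yes q = ⊥-elim (¬p (from n ≤-refl q))
  ... | no _ | no _ = count-cong P? Q? n (λ y y<n → to y (m<n⇒m<1+n y<n)) (λ y y<n → from y (m<n⇒m<1+n y<n))

  count-split : {P Q : Pred ℕ 0ℓ} (P? : Decidable P) (Q? : Decidable Q) (n : ℕ) →
                count P? n ≡ count (λ y → P? y ×-dec Q? y) n + count (λ y → P? y ×-dec ¬? (Q? y)) n
  count-split P? Q? zero = refl
  count-split P? Q? (suc n) with P? n | Q? n
  ... | yes _ | yes _ = cong suc (count-split P? Q? n)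
  ... | yes _ | no _ = trans (cong suc (count-split P? Q? n)) (sym (+-suc _ _))
  ... | no _ | _ = count-split P? Q? n

  count-+ : {P : Pred ℕ 0ℓ} (P? : Decidable P) (m k : ℕ) →
            count P? (m + k) ≡ count P? m + count (λ y → P? (m + y)) k
  count-+ P? m zero rewrite +-identityʳ m = sym (+-identityʳ _)
  count-+ P? m (suc k) rewrite +-suc m k with P? (m + k)
  ... | yes _ = trans (cong suc (count-+ P? m k)) (sym (+-suc _ _))
  ... | no _ = count-+ P? m k

  count-none : {P : Pred ℕ 0ℓ} (P? : Decidable P) (n : ℕ) → (∀ y → y < n → ¬ P y) → count P? n ≡ 0
  count-none P? zero none = refl
  count-none P? (suc n) none with P? n
  ... | yes p = ⊥-elim (none n ≤-refl p)
  ... | no _ = count-none P? n (λ y y<n → none y (m<n⇒m<1+n y<n))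

  count-unique : {P : Pred ℕ 0ℓ} (P? : Decidable P) (n r : ℕ) → r < n →
                 (∀ y → y < n → P y → y ≡ r) → P r → count P? n ≡ 1
  count-unique P? (suc n) r r<1+n unique pr with P? n
  ... | yes p = cong suc (count-none P? n (λ y y<n py →
                  <-irrefl (trans (unique y (m<n⇒m<1+n y<n) py) (sym (unique n ≤-refl p))) y<n))
  ... | no ¬p with m≤n⇒m<n∨m≡n (≤-pred r<1+n)
  ...   | inj₁ r<n = count-unique P? n r r<n (λ y y<n → unique y (m<n⇒m<1+n y<n)) pr
  ...   | inj₂ refl = ⊥-elim (¬p pr)

  count-multiples : {P : Pred ℕ 0ℓ} (P? : Decidable P) (T : ℕ) .{{_ : NonZero T}} →
                    (∀ x → P x → T ∣ x) → (R : ℕ) → count P? (T * R) ≡ count (λ y → P? (T * y)) R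
  count-multiples P? T multiple zero rewrite *-zeroʳ T = refl
  count-multiples {P} P? T@(suc T') multiple (suc R) = begin
      count P? (T * suc R)                                         ≡⟨ cong (count P?) (trans (*-suc T R) (+-comm T (T * R))) ⟩
      count P? (T * R + (1 + T'))                                  ≡⟨ count-+ P? (T * R) (1 + T') ⟩
      count P? (T * R) + count (λ y → P? (T * R + y)) (1 + T')     ≡⟨ cong (count P? (T * R) +_) (count-+ (λ y → P? (T * R + y)) 1 T') ⟩
      count P? (T * R) + (count (λ y → P? (T * R + y)) 1 + count (λ y → P? (T * R + suc y)) T')
                                                                     ≡⟨ cong₂ (λ u v → u + (count (λ y → P? (T * R + y)) 1 + v)) (count-multiples P? T multiple R) nonMultiples ⟩
      count Q? R + (count (λ y → P? (T * R + y)) 1 + 0)            ≡⟨ cong (λ u → count Q? R + u) lastBlock ⟩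
      count Q? R + count (λ y → Q? (R + y)) 1                      ≡⟨ sym (count-+ Q? R 1) ⟩
      count Q? (R + 1)                                             ≡⟨ cong (count Q?) (+-comm R 1) ⟩
      count Q? (suc R)                                             ∎
    where
    Q? = λ y → P? (T * y)
    -- T·R + 1 + y with y < T - 1 is not a multiple of T, so it is no witness.
    nonMultiples : count (λ y → P? (T * R + suc y)) T' ≡ 0
    nonMultiples = count-none _ T' (λ y y<T' p →
      <-irrefl refl (≤-trans (s≤s y<T') (∣⇒≤ (∣m+n∣m⇒∣n (multiple _ p) (m∣m*n R)))))
    lastBlock : count (λ y → P? (T * R + y)) 1 + 0 ≡ count (λ y → Q? (R + y)) 1
    lastBlock = trans (+-identityʳ _) (count-cong (λ y → P? (T * R + y)) (λ y → Q? (R + y)) 1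
      (λ { .0 (s≤s z≤n) p → subst P (sym shift) p }) (λ { .0 (s≤s z≤n) p → subst P shift p }))
      where
      shift : T * (R + 0) ≡ T * R + 0
      shift = trans (cong (T *_) (+-identityʳ R)) (sym (+-identityʳ (T * R)))


-- The relation ℤ∣._∣_ of Data.Integer.Divisibility is
-- ℕ-divisibility of absolute values, which is how the congruences are stated;
-- the signed relation _∣ˢ_ is the one that interacts with ring operations, and
-- ∣ᵤ⇒∣ / ∣⇒∣ᵤ convert between the two.
module IntegerDivisibility where

  open Counting
  open import Defs using (_∣ℤ?_)
  open import Data.Nat as ℕ using (ℕ; zero; suc; NonZero; _<_; _∸_)
  import Data.Nat.Properties as ℕ
  import Data.Nat.Divisibility as ℕ
  open import Data.Nat.GCD using (module Bézout)
  open import Data.Nat.Coprimality using (Coprime; coprime-Bézout)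
  open import Data.Integer using (ℤ; +_; -[1+_]; ∣_∣; _-_; _+_; _*_; -_; 1ℤ; -1ℤ)
  import Data.Integer.Properties as ℤ
  import Data.Integer.Divisibility as ℤ∣
  open import Data.Integer.Divisibility.Signed using (∣ᵤ⇒∣; ∣⇒∣ᵤ; ∣m+n∣n⇒∣m; ∣m⇒∣m*n; ∣n⇒∣m*n; ∣m∣n⇒∣m+n; ∣m∣n⇒∣m-n)
    renaming (_∣_ to _∣ˢ_; ∣-refl to ∣ˢ-refl; divides to dividesˢ)
  open import Data.Integer.Tactic.RingSolver using (solve-∀)
  open import Data.Integer.DivMod using (_%ℕ_; _/ℕ_; a≡a%ℕn+[a/ℕn]*n; n%ℕd<d)
  open import Data.Product using (∃; _,_)
  open import Data.Sum using (inj₁; inj₂)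
  open import Relation.Nullary using (contradiction)
  open import Relation.Binary.PropositionalEquality
  open ≡-Reasoning

  multiple-below⇒0 : ∀ {K z} → K ℕ.∣ z → z < K → z ≡ 0
  multiple-below⇒0 {K} {zero} _ _ = refl
  multiple-below⇒0 {K} {suc z} K∣z z<K = contradiction (ℕ.∣⇒≤ K∣z) (ℕ.<⇒≱ z<K)

  congruent-residues : ∀ K {y r} → y < K → r < K → (+ K) ℤ∣.∣ (+ y - + r) → y ≡ r
  congruent-residues K {y} {r} y<K r<K K∣y-r with ℕ.≤-total r y
  ... | inj₁ r≤y = ℕ.≤-antisym (ℕ.m∸n≡0⇒m≤n y∸r≡0) r≤y
    where
    y∸r≡0 : y ∸ r ≡ 0
    y∸r≡0 = multiple-below⇒0 (subst (K ℕ.∣_) (cong ∣_∣ (trans (ℤ.m-n≡m⊖n y r) (ℤ.⊖-≥ r≤y))) K∣y-r)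
                             (ℕ.≤-<-trans (ℕ.m∸n≤m y r) y<K)
  ... | inj₂ y≤r = ℕ.≤-antisym y≤r (ℕ.m∸n≡0⇒m≤n r∸y≡0)
    where
    r∸y≡0 : r ∸ y ≡ 0
    r∸y≡0 = multiple-below⇒0 (subst (K ℕ.∣_) (trans (cong ∣_∣ (trans (ℤ.m-n≡m⊖n y r) (ℤ.⊖-≤ y≤r))) (ℤ.∣-i∣≡∣i∣ (+ (r ∸ y)))) K∣y-r)
                             (ℕ.≤-<-trans (ℕ.m∸n≤m r y) r<K)

  count-residueClass : (K : ℕ) .{{_ : NonZero K}} (c : ℤ) (R : ℕ) →
                       count (λ y → (+ K) ∣ℤ? (+ y - c)) (K ℕ.* R) ≡ R
  count-residueClass K c zero rewrite ℕ.*-zeroʳ K = refl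
  count-residueClass K c (suc R) = begin
      count P? (K ℕ.* suc R)                                         ≡⟨ cong (count P?) (trans (ℕ.*-suc K R) (ℕ.+-comm K (K ℕ.* R))) ⟩
      count P? (K ℕ.* R ℕ.+ K)                                       ≡⟨ count-+ P? (K ℕ.* R) K ⟩
      count P? (K ℕ.* R) ℕ.+ count (λ y → P? (K ℕ.* R ℕ.+ y)) K     ≡⟨ cong₂ ℕ._+_ (count-residueClass K c R) oneInLastBlock ⟩
      R ℕ.+ 1                                                        ≡⟨ ℕ.+-comm R 1 ⟩
      suc R                                                          ∎
    where
    P? = λ y → (+ K) ∣ℤ? (+ y - c)
    r = c %ℕ K
    q = c /ℕ K
    -- In the block [K·R, K·R + K) the class is represented by K·R + (c mod K).
    shift : ∀ y → + (K ℕ.* R ℕ.+ y) - c ≡ (+ y - + r) + + K * (+ R - q)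
    shift y = begin
      + (K ℕ.* R ℕ.+ y) - c                ≡⟨ cong₂ _-_ (trans (ℤ.pos-+ (K ℕ.* R) y) (cong (_+ + y) (ℤ.pos-* K R))) (a≡a%ℕn+[a/ℕn]*n c K) ⟩
      (+ K * + R + + y) - (+ r + q * + K)  ≡⟨ ring (+ K) (+ R) (+ y) (+ r) q ⟩
      (+ y - + r) + + K * (+ R - q)        ∎
      where
      ring : ∀ k R y r q → (k * R + y) - (r + q * k) ≡ (y - r) + k * (R - q)
      ring = solve-∀
    K∣K[R-q] : (+ K) ∣ˢ (+ K * (+ R - q))
    K∣K[R-q] = ∣m⇒∣m*n (+ R - q) ∣ˢ-refl
    oneInLastBlock : count (λ y → P? (K ℕ.* R ℕ.+ y)) K ≡ 1
    oneInLastBlock = count-unique (λ y → P? (K ℕ.* R ℕ.+ y)) K r (n%ℕd<d c K)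
      (λ y y<K K∣ → congruent-residues K y<K (n%ℕd<d c K)
         (∣⇒∣ᵤ {+ K} {+ y - + r} (∣m+n∣n⇒∣m (subst (+ K ∣ˢ_) (shift y) (∣ᵤ⇒∣ {+ K} {+ (K ℕ.* R ℕ.+ y) - c} K∣)) K∣K[R-q])))
      (∣⇒∣ᵤ {+ K} {+ (K ℕ.* R ℕ.+ r) - c} (subst (+ K ∣ˢ_) (sym (shift r))
         (∣m∣n⇒∣m+n (subst (+ K ∣ˢ_) (sym (ℤ.+-inverseʳ (+ r))) (dividesˢ (+ 0) refl)) K∣K[R-q])))

  exact-division : ∀ (b : ℤ) (T : ℕ) .{{_ : NonZero T}} → T ℕ.∣ ∣ b ∣ → b ≡ (b /ℕ T) * + T
  exact-division b T T∣b = begin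
      b                          ≡⟨ a≡a%ℕn+[a/ℕn]*n b T ⟩
      + r + (b /ℕ T) * + T       ≡⟨ cong (λ z → + z + (b /ℕ T) * + T) r≡0 ⟩
      + 0 + (b /ℕ T) * + T       ≡⟨ ℤ.+-identityˡ _ ⟩
      (b /ℕ T) * + T             ∎
    where
    r = b %ℕ T
    T∣r : (+ T) ∣ˢ (+ r)
    T∣r = subst (+ T ∣ˢ_) (ring (+ r) ((b /ℕ T) * + T))
            (∣m∣n⇒∣m-n (subst (+ T ∣ˢ_) (a≡a%ℕn+[a/ℕn]*n b T) (∣ᵤ⇒∣ {+ T} {b} T∣b)) (∣n⇒∣m*n (b /ℕ T) ∣ˢ-refl))
      where
      ring : ∀ x y → (x + y) - y ≡ x
      ring = solve-∀
    r≡0 : r ≡ 0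
    r≡0 = multiple-below⇒0 (∣⇒∣ᵤ {+ T} {+ r} T∣r) (n%ℕd<d b T)

  sign-of : ∀ X → ∃ λ σ → X * σ ≡ + ∣ X ∣
  sign-of (+ n) = 1ℤ , ℤ.*-identityʳ (+ n)
  sign-of -[1+ n ] = -1ℤ , trans (ℤ.*-comm -[1+ n ] -1ℤ) (ℤ.-1*i≡-i -[1+ n ])

  inverse-mod : ∀ (X : ℤ) (K : ℕ) → Coprime ∣ X ∣ K → ∃ λ u → (+ K) ∣ˢ (X * u - + 1)
  inverse-mod X K cop with coprime-Bézout cop | sign-of X
  ... | Bézout.+- x y eq | σ , Xσ≡∣X∣ = σ * + x , dividesˢ (+ y) (begin
      X * (σ * + x) - + 1     ≡⟨ ring X σ (+ x) ⟩
      (X * σ) * + x - + 1     ≡⟨ cong (λ z → z * + x - + 1) Xσ≡∣X∣ ⟩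
      + ∣ X ∣ * + x - + 1     ≡⟨ cong (_- + 1) (trans (sym (ℤ.pos-* ∣ X ∣ x)) (cong +_ (ℕ.*-comm ∣ X ∣ x))) ⟩
      + (x ℕ.* ∣ X ∣) - + 1   ≡⟨ cong (λ z → + z - + 1) (sym eq) ⟩
      + (1 ℕ.+ y ℕ.* K) - + 1 ≡⟨ cong (_- + 1) (trans (ℤ.pos-+ 1 (y ℕ.* K)) (cong (λ z → + 1 + z) (ℤ.pos-* y K))) ⟩
      (+ 1 + + y * + K) - + 1 ≡⟨ cancel (+ y) (+ K) ⟩
      + y * + K               ∎)
    where
    ring : ∀ a b c → a * (b * c) - + 1 ≡ (a * b) * c - + 1
    ring = solve-∀
    cancel : ∀ a b → (+ 1 + a * b) - + 1 ≡ a * b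
    cancel = solve-∀
  ... | Bézout.-+ x y eq | σ , Xσ≡∣X∣ = σ * (- + x) , dividesˢ (- + y) (begin
      X * (σ * (- + x)) - + 1    ≡⟨ ring X σ (+ x) ⟩
      - ((X * σ) * + x + + 1)    ≡⟨ cong (λ z → - (z * + x + + 1)) Xσ≡∣X∣ ⟩
      - (+ ∣ X ∣ * + x + + 1)    ≡⟨ cong (λ z → - (z + + 1)) (trans (sym (ℤ.pos-* ∣ X ∣ x)) (cong +_ (ℕ.*-comm ∣ X ∣ x))) ⟩
      - (+ (x ℕ.* ∣ X ∣) + + 1)  ≡⟨ cong -_ (trans (sym (ℤ.pos-+ (x ℕ.* ∣ X ∣) 1)) (cong +_ (ℕ.+-comm _ 1))) ⟩
      - + (1 ℕ.+ x ℕ.* ∣ X ∣)    ≡⟨ cong (λ z → - + z) eq ⟩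
      - + (y ℕ.* K)              ≡⟨ cong -_ (ℤ.pos-* y K) ⟩
      - (+ y * + K)              ≡⟨ ℤ.neg-distribˡ-* (+ y) (+ K) ⟩
      (- + y) * + K              ∎)
    where
    ring : ∀ a b c → a * (b * (- c)) - + 1 ≡ - ((a * b) * c + + 1)
    ring = solve-∀


  ∣-difference⇒∣ʳ : ∀ k u v → k ℕ.∣ ∣ u ∣ → k ℕ.∣ ∣ u - v ∣ → k ℕ.∣ ∣ v ∣
  ∣-difference⇒∣ʳ k u v k∣u k∣u-v = ∣⇒∣ᵤ {+ k} {v} (subst (+ k ∣ˢ_) (ring u v)
    (∣m∣n⇒∣m-n (∣ᵤ⇒∣ {+ k} {u} k∣u) (∣ᵤ⇒∣ {+ k} {u - v} k∣u-v)))
    where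
    ring : ∀ u v → u - (u - v) ≡ v
    ring = solve-∀

  ∣-difference⇒∣ˡ : ∀ k u v → k ℕ.∣ ∣ u - v ∣ → k ℕ.∣ ∣ v ∣ → k ℕ.∣ ∣ u ∣
  ∣-difference⇒∣ˡ k u v k∣u-v k∣v = ∣⇒∣ᵤ {+ k} {u} (subst (+ k ∣ˢ_) (ring u v)
    (∣m∣n⇒∣m+n (∣ᵤ⇒∣ {+ k} {u - v} k∣u-v) (∣ᵤ⇒∣ {+ k} {v} k∣v)))
    where
    ring : ∀ u v → (u - v) + v ≡ u
    ring = solve-∀

  ∣-+ : ∀ k u v → k ℕ.∣ ∣ u ∣ → k ℕ.∣ ∣ v ∣ → k ℕ.∣ ∣ u + v ∣
  ∣-+ k u v k∣u k∣v = ∣⇒∣ᵤ {+ k} {u + v} (∣m∣n⇒∣m+n (∣ᵤ⇒∣ {+ k} {u} k∣u) (∣ᵤ⇒∣ {+ k} {v} k∣v))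

  ∣-+⇒∣ˡ : ∀ k u v → k ℕ.∣ ∣ u + v ∣ → k ℕ.∣ ∣ v ∣ → k ℕ.∣ ∣ u ∣
  ∣-+⇒∣ˡ k u v k∣u+v k∣v = ∣⇒∣ᵤ {+ k} {u} (∣m+n∣n⇒∣m (∣ᵤ⇒∣ {+ k} {u + v} k∣u+v) (∣ᵤ⇒∣ {+ k} {v} k∣v))


module Powers where

  open import Data.Nat using (ℕ; zero; suc; _*_; _^_; _≤_; NonZero; ≢-nonZero; ≢-nonZero⁻¹)
  open import Data.Nat.Properties
  open import Data.Nat.Divisibility
  open import Data.Nat.GCD using (gcd; gcd[m,n]∣m; gcd[m,n]∣n; gcd[m,n]≢0)
  open import Data.Nat.Coprimality using (Coprime; coprime-divisor; coprime-/gcd) renaming (sym to coprime-sym)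
  open import Data.Nat.DivMod using (_/_; m*[n/m]≡n)
  open import Data.Nat.Primality
  open import Data.Nat.Primality.Factorisation using (factorise)
  open import Data.Nat.ListAction using (product)
  open import Data.Nat.Tactic.RingSolver using (solve-∀)
  open import Data.List using ([]; _∷_)
  open import Data.List.Relation.Unary.All using (_∷_)
  open import Data.Product using (_×_; _,_; ∃-syntax)
  open import Data.Sum using (inj₁; inj₂; [_,_]′)
  open import Data.Empty using (⊥-elim)
  open import Relation.Nullary using (¬_)
  open import Relation.Binary.PropositionalEquality

  ^-distribʳ-* : ∀ a b s → (a * b) ^ s ≡ a ^ s * b ^ s
  ^-distribʳ-* a b zero = refl
  ^-distribʳ-* a b (suc s) rewrite ^-distribʳ-* a b s = interchange a b (a ^ s) (b ^ s)
    where
    interchange : ∀ x y z w → x * y * (z * w) ≡ x * z * (y * w)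
    interchange = solve-∀

  ^-monoˡ-∣ : ∀ s {a b} → a ∣ b → a ^ s ∣ b ^ s
  ^-monoˡ-∣ zero _ = ∣-refl
  ^-monoˡ-∣ (suc s) a∣b = *-pres-∣ a∣b (^-monoˡ-∣ s a∣b)

  m∣m^s : ∀ s .{{_ : NonZero s}} m → m ∣ m ^ s
  m∣m^s (suc s) m = m∣m*n (m ^ s)

  coprime-* : ∀ {a b c} → Coprime a b → Coprime a c → Coprime a (b * c)
  coprime-* cab cac (d∣a , d∣bc) =
    cac (d∣a , coprime-divisor (λ (e∣d , e∣b) → cab (∣-trans e∣d d∣a , e∣b)) d∣bc)

  coprime-^ʳ : ∀ s {a b} → Coprime a b → Coprime a (b ^ s)
  coprime-^ʳ zero _ (_ , d∣1) = ∣1⇒≡1 d∣1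
  coprime-^ʳ (suc s) cop = coprime-* cop (coprime-^ʳ s cop)

  coprime-^ : ∀ s {a b} → Coprime a b → Coprime (a ^ s) (b ^ s)
  coprime-^ s cop = coprime-sym (coprime-^ʳ s (coprime-sym (coprime-^ʳ s cop)))

  coprime-*-∣ : ∀ {a b z} → Coprime a b → a ∣ z → b ∣ z → a * b ∣ z
  coprime-*-∣ {a} {b} cop (divides w refl) b∣wa =
    subst (a * b ∣_) (*-comm a w)
      (*-monoʳ-∣ a (coprime-divisor (coprime-sym cop) (subst (b ∣_) (*-comm w a) b∣wa)))

  record GcdSplit (k l : ℕ) : Set where
    field
      g k₁ l₁ : ℕ
      g≢0 : NonZero g
      k≡gk₁ : k ≡ g * k₁
      l≡gl₁ : l ≡ g * l₁
      coprime : Coprime k₁ l₁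

  gcdSplit : ∀ k l → .{{NonZero k}} → GcdSplit k l
  gcdSplit k l = record
    { g = gcd k l ; k₁ = k / gcd k l ; l₁ = l / gcd k l ; g≢0 = gcd≢0
    ; k≡gk₁ = sym (m*[n/m]≡n (gcd[m,n]∣m k l)) ; l≡gl₁ = sym (m*[n/m]≡n (gcd[m,n]∣n k l))
    ; coprime = coprime-/gcd k l }
    where
    instance
      gcd≢0 : NonZero (gcd k l)
      gcd≢0 = ≢-nonZero (gcd[m,n]≢0 k l (inj₁ (≢-nonZero⁻¹ k)))

  cofactor≡1⇒∣ : ∀ {k l} (sp : GcdSplit k l) → GcdSplit.k₁ sp ≡ 1 → k ∣ l
  cofactor≡1⇒∣ {k} {l} sp k₁≡1 =
    subst (_∣ l) (sym (trans k≡gk₁ (trans (cong (g *_) k₁≡1) (*-identityʳ g))))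
          (subst (g ∣_) (sym l≡gl₁) (m∣m*n l₁))
    where open GcdSplit sp

  ^-cancel-∣ : ∀ s .{{_ : NonZero s}} {k l} → k ^ s ∣ l ^ s → k ∣ l
  ^-cancel-∣ s@(suc _) {zero} {l} 0∣l^s = subst (0 ∣_) (sym (m^n≡0⇒m≡0 l s (0∣⇒≡0 0∣l^s))) ∣-refl
  ^-cancel-∣ s@(suc _) {k@(suc _)} {l} k^s∣l^s = cofactor≡1⇒∣ sp k₁≡1
    where
    sp = gcdSplit k l
    open GcdSplit sp
    instance
      g^s≢0 : NonZero (g ^ s)
      g^s≢0 = m^n≢0 g s {{g≢0}}
    split : g ^ s * k₁ ^ s ∣ g ^ s * l₁ ^ s
    split = subst₂ _∣_ (trans (cong (_^ s) k≡gk₁) (^-distribʳ-* g k₁ s))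
                       (trans (cong (_^ s) l≡gl₁) (^-distribʳ-* g l₁ s)) k^s∣l^s
    k₁^s∣1 : k₁ ^ s ∣ 1
    k₁^s∣1 = coprime-divisor (coprime-^ s coprime) (subst (k₁ ^ s ∣_) (sym (*-identityʳ _)) (*-cancelˡ-∣ (g ^ s) split))
    k₁≡1 : k₁ ≡ 1
    k₁≡1 = ∣1⇒≡1 (subst (k₁ ∣_) (∣1⇒≡1 k₁^s∣1) (m∣m^s s k₁))

  ^-injectiveˡ : ∀ s .{{_ : NonZero s}} {k l} → k ^ s ≡ l ^ s → k ≡ l
  ^-injectiveˡ s e = ∣-antisym (^-cancel-∣ s (∣-reflexive e)) (^-cancel-∣ s (∣-reflexive (sym e)))

  prime-divisor : ∀ n → 2 ≤ n → ∃[ p ] Prime p × p ∣ n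
  prime-divisor n@(suc _) 2≤n with factorise n
  ... | record { factors = [] ; isFactorisation = e } = ⊥-elim (<-irrefl (sym e) 2≤n)
  ... | record { factors = p ∷ ps ; isFactorisation = e ; factorsPrime = prime-p ∷ _ } =
    p , prime-p , subst (p ∣_) (sym e) (m∣m*n (product ps))

  prime⇒≢1 : ∀ {p} → Prime p → p ≢ 1
  prime⇒≢1 prime-p refl = ¬prime[1] prime-p

  prime-∤⇒coprime : ∀ {p x} → Prime p → ¬ p ∣ x → Coprime p x
  prime-∤⇒coprime prime-p p∤x (d∣p , d∣x) with prime⇒irreducible prime-p d∣p
  ... | inj₁ d≡1 = d≡1
  ... | inj₂ refl = ⊥-elim (p∤x d∣x)

  distinct-primes-coprime : ∀ {p q} → Prime p → Prime q → p ≢ q → Coprime p q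
  distinct-primes-coprime prime-p prime-q p≢q = prime-∤⇒coprime prime-p λ p∣q →
    [ prime⇒≢1 prime-p , p≢q ]′ (prime⇒irreducible prime-q p∣q)


-- The generalized gcd: (a,b)_s = L^s where L = genGcdBase s a b is characterised
-- by  L^s ∣ a,  L^s ∣ b  and  k^s ∣ a, k^s ∣ b ⇒ k ∣ L  (for (a,b) ≠ (0,0)).
module GeneralizedGcd where

  open import Defs
  open Powers
  open import Data.Nat using (ℕ; zero; suc; _+_; _*_; _^_; _≤_; NonZero; ≢-nonZero⁻¹; >-nonZero; >-nonZero⁻¹)
  open import Data.Nat.Properties
  open import Data.Nat.Divisibility
  open import Data.Nat.GCD using (gcd; gcd[m,n]∣m; gcd[m,n]∣n; gcd-greatest)
  open import Data.Nat.Coprimality using (Coprime; coprime-divisor) renaming (sym to coprime-sym)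
  open import Data.Integer as ℤ using (ℤ; +_) renaming (∣_∣ to abs)
  import Data.Integer.Properties as ℤ
  open import Data.Product using (_×_; _,_; proj₁; proj₂)
  open import Data.Sum using (_⊎_; inj₁; inj₂)
  open import Data.Empty using (⊥-elim)
  open import Relation.Nullary using (yes; no)
  open import Relation.Nullary.Decidable using (_×-dec_)
  open import Relation.Unary using (Pred; Decidable)
  open import Level using (0ℓ)
  open import Relation.Binary.PropositionalEquality

  largestUpTo-maximal : {P : Pred ℕ 0ℓ} (P? : Decidable P) (N l : ℕ) → P l → 1 ≤ l → l ≤ N → l ≤ largestUpTo P? N
  largestUpTo-maximal P? zero l pl 1≤l l≤0 = ⊥-elim (<-irrefl refl (≤-trans 1≤l l≤0))
  largestUpTo-maximal P? (suc N) l pl 1≤l l≤1+N with P? (suc N)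
  ... | yes _ = l≤1+N
  ... | no ¬p with m≤n⇒m<n∨m≡n l≤1+N
  ...   | inj₁ l<1+N = largestUpTo-maximal P? N l pl 1≤l (≤-pred l<1+N)
  ...   | inj₂ refl = ⊥-elim (¬p pl)

  largestUpTo-witness : {P : Pred ℕ 0ℓ} (P? : Decidable P) (N : ℕ) → largestUpTo P? N ≡ 0 ⊎ P (largestUpTo P? N)
  largestUpTo-witness P? zero = inj₁ refl
  largestUpTo-witness P? (suc N) with P? (suc N)
  ... | yes p = inj₂ p
  ... | no _ = largestUpTo-witness P? N

  abs-^ : ∀ a s → abs (a ℤ.^ s) ≡ abs a ^ s
  abs-^ a zero = refl
  abs-^ a (suc s) = trans (ℤ.abs-* a (a ℤ.^ s)) (cong (abs a *_) (abs-^ a s))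

  -- For a common divisor l^s of a and b, one of which is nonzero, l ≤ |a| + |b|:
  -- this is why genGcdBase may stop its search at |a| + |b|.
  private
    bounded : ∀ s .{{_ : NonZero s}} l .{{_ : NonZero l}} {X Y} → NonZero (X + Y) →
              l ^ s ∣ X → l ^ s ∣ Y → l ≤ X + Y
    bounded s l {suc X} {Y} _ l^s∣X _ =
      ≤-trans (∣⇒≤ {{m^n≢0 l s}} (m∣m^s s l)) (≤-trans (∣⇒≤ l^s∣X) (m≤m+n (suc X) Y))
    bounded s l {zero} {suc Y} _ _ l^s∣Y = ≤-trans (∣⇒≤ {{m^n≢0 l s}} (m∣m^s s l)) (∣⇒≤ l^s∣Y)

    lcm-power-∣ : ∀ s {g L₁ k₁ X} .{{_ : NonZero g}} → Coprime L₁ k₁ →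
                  (g * L₁) ^ s ∣ X → (g * k₁) ^ s ∣ X → (g * L₁ * k₁) ^ s ∣ X
    lcm-power-∣ s {g} {L₁} {k₁} cop (divides w refl) gk₁^s∣ =
      subst (_∣ w * (g * L₁) ^ s) (sym (^-distribʳ-* (g * L₁) k₁ s))
        (subst ((g * L₁) ^ s * k₁ ^ s ∣_) (*-comm ((g * L₁) ^ s) w) (*-monoʳ-∣ ((g * L₁) ^ s) k₁^s∣w))
      where
      instance
        g^s≢0 : NonZero (g ^ s)
        g^s≢0 = m^n≢0 g s
      regroup : w * (g * L₁) ^ s ≡ g ^ s * (L₁ ^ s * w)
      regroup = trans (cong (w *_) (^-distribʳ-* g L₁ s))
                      (trans (*-comm w (g ^ s * L₁ ^ s)) (*-assoc (g ^ s) (L₁ ^ s) w))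
      k₁^s∣w : k₁ ^ s ∣ w
      k₁^s∣w = coprime-divisor (coprime-^ s (coprime-sym cop))
        (*-cancelˡ-∣ (g ^ s) (subst₂ _∣_ (^-distribʳ-* g k₁ s) regroup gk₁^s∣))

  module GenGcdBase (s : ℕ) .{{_ : NonZero s}} (a b : ℤ) (nonzero : NonZero (abs a + abs b)) where

    L : ℕ
    L = genGcdBase s a b

    private
      P? = λ l → ((+ (l ^ s)) ∣ℤ? a) ×-dec ((+ (l ^ s)) ∣ℤ? b)
      1≤|a|+|b| : 1 ≤ abs a + abs b
      1≤|a|+|b| = >-nonZero⁻¹ _ {{nonzero}}

      1≤L : 1 ≤ L
      1≤L = largestUpTo-maximal P? (abs a + abs b) 1
              (subst (_∣ abs a) (sym (^-zeroˡ s)) (1∣ _) , subst (_∣ abs b) (sym (^-zeroˡ s)) (1∣ _))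
              ≤-refl 1≤|a|+|b|

    instance
      L≢0 : NonZero L
      L≢0 = >-nonZero 1≤L

    L^s∣a×L^s∣b : L ^ s ∣ abs a × L ^ s ∣ abs b
    L^s∣a×L^s∣b with largestUpTo-witness P? (abs a + abs b)
    ... | inj₁ L≡0 = ⊥-elim (<-irrefl (sym L≡0) 1≤L)
    ... | inj₂ divides-both = divides-both

    L^s∣a : L ^ s ∣ abs a
    L^s∣a = proj₁ L^s∣a×L^s∣b

    L^s∣b : L ^ s ∣ abs b
    L^s∣b = proj₂ L^s∣a×L^s∣b

    -- Universal property: every l with l^s dividing a and b divides L.  With
    -- L = g·L₁, k = g·k₁ (g = gcd), the number L·k₁ is again such an l, so
    -- maximality of L forces k₁ = 1.
    L-greatest : ∀ k → k ^ s ∣ abs a → k ^ s ∣ abs b → k ∣ L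
    L-greatest zero 0∣a 0∣b = ⊥-elim (≢-nonZero⁻¹ _ {{nonzero}} (cong₂ _+_ (zero^s∣⇒≡0 0∣a) (zero^s∣⇒≡0 0∣b)))
      where
      zero^s∣⇒≡0 : ∀ {X} → 0 ^ s ∣ X → X ≡ 0
      zero^s∣⇒≡0 {X} p = 0∣⇒≡0 (subst (_∣ X) (^-zeroʳ⁺ s) p)
        where
        ^-zeroʳ⁺ : ∀ s → .{{NonZero s}} → 0 ^ s ≡ 0
        ^-zeroʳ⁺ (suc _) = refl
    L-greatest k@(suc _) k^s∣a k^s∣b = ∣-trans (∣-reflexive k≡g) (subst (g ∣_) (sym L≡gL₁) (m∣m*n L₁))
      where
      open GcdSplit (gcdSplit L k) renaming (k₁ to L₁; l₁ to k₁; k≡gk₁ to L≡gL₁; l≡gl₁ to k≡gk₁)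
      instance
        g-nonZero : NonZero g
        g-nonZero = g≢0
      k₁≢0 : NonZero k₁
      k₁≢0 with k₁ | k≡gk₁
      ... | zero | e = ⊥-elim (1+n≢0 (trans e (*-zeroʳ g)))
      ... | suc _ | _ = _
      l : ℕ
      l = g * L₁ * k₁
      l≡Lk₁ : l ≡ L * k₁
      l≡Lk₁ = cong (_* k₁) (sym L≡gL₁)
      l^s∣ : ∀ {X} → L ^ s ∣ X → k ^ s ∣ X → l ^ s ∣ X
      l^s∣ {X} L^s∣X k^s∣X = lcm-power-∣ s {g} {L₁} {k₁} coprime (subst (λ z → z ^ s ∣ X) L≡gL₁ L^s∣X) (subst (λ z → z ^ s ∣ X) k≡gk₁ k^s∣X)
      instance
        l≢0 : NonZero l
        l≢0 = subst NonZero (sym l≡Lk₁) (m*n≢0 L k₁ {{L≢0}} {{k₁≢0}})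
      Lk₁≤L*1 : L * k₁ ≤ L * 1
      Lk₁≤L*1 = subst₂ _≤_ l≡Lk₁ (sym (*-identityʳ L))
        (largestUpTo-maximal P? (abs a + abs b) l (l^s∣ L^s∣a k^s∣a , l^s∣ L^s∣b k^s∣b) (>-nonZero⁻¹ l)
          (bounded s l nonzero (l^s∣ L^s∣a k^s∣a) (l^s∣ L^s∣b k^s∣b)))
      k≡g : k ≡ g
      k≡g = trans k≡gk₁ (trans (cong (g *_) (≤-antisym (*-cancelˡ-≤ L Lk₁≤L*1) (>-nonZero⁻¹ k₁ {{k₁≢0}}))) (*-identityʳ g))

  genGcdBase-^ : ∀ s .{{_ : NonZero s}} (a : ℤ) (m : ℕ) .{{_ : NonZero m}} →
                 genGcdBase s (a ℤ.^ s) (+ (m ^ s)) ≡ gcd (abs a) m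
  genGcdBase-^ s a m = ∣-antisym L∣gcd gcd∣L
    where
    nonzero : NonZero (abs (a ℤ.^ s) + m ^ s)
    nonzero = >-nonZero (≤-trans (>-nonZero⁻¹ _ {{m^n≢0 m s}}) (m≤n+m (m ^ s) _))
    open GenGcdBase s (a ℤ.^ s) (+ (m ^ s)) nonzero
    L∣gcd : L ∣ gcd (abs a) m
    L∣gcd = gcd-greatest (^-cancel-∣ s (subst (L ^ s ∣_) (abs-^ a s) L^s∣a)) (^-cancel-∣ s L^s∣b)
    gcd∣L : gcd (abs a) m ∣ L
    gcd∣L = L-greatest _ (subst (gcd (abs a) m ^ s ∣_) (sym (abs-^ a s)) (^-monoˡ-∣ s (gcd[m,n]∣m (abs a) m)))
                         (^-monoˡ-∣ s (gcd[m,n]∣n (abs a) m))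


module Rationals where

  open import Defs using (factor)
  open import Data.Nat as ℕ using (ℕ; zero; suc; NonZero; _^_; _≤_; s≤s)
  import Data.Nat.Properties as ℕ
  import Data.Nat.Divisibility as ℕ
  open import Data.Nat.Coprimality using (Coprime)
  open import Data.Nat.Primality using (Prime; prime⇒nonTrivial)
  open import Data.Integer as ℤ using (+_)
  import Data.Integer.Properties as ℤ
  open import Data.Rational as ℚ using (ℚ; mkℚ; 1ℚ; _*_; _+_; _-_; Positive)
  import Data.Rational.Properties as ℚ
  open import Data.Rational.Solver using (module +-*-Solver)
  open +-*-Solver
  open import Data.List using (List; []; _∷_; foldr; filter)
  open import Data.List.Relation.Unary.All using (All; []; _∷_)
  open import Data.Product using (_,_)
  open import Relation.Nullary using (yes; no)
  open import Relation.Nullary.Decidable using (_×-dec_; ¬?)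
  open import Relation.Unary using (Pred; Decidable)
  open import Level using (0ℓ)
  open import Relation.Binary.PropositionalEquality
  open ≡-Reasoning

  ι : ℕ → ℚ
  ι n = + n ℚ./ 1

  private
    coprime-1 : ∀ n → Coprime n 1
    coprime-1 n (_ , d∣1) = ℕ.∣1⇒≡1 d∣1

    ι-mkℚ : ∀ n → ι n ≡ mkℚ (+ n) 0 (coprime-1 n)
    ι-mkℚ n = ℚ.normalize-coprime (coprime-1 n)

  ι-* : ∀ m n → ι (m ℕ.* n) ≡ ι m * ι n
  ι-* m n = begin
    ι (m ℕ.* n)                                        ≡⟨ cong (ℚ._/ 1) (ℤ.pos-* m n) ⟩
    (+ m ℤ.* + n) ℚ./ 1                                ≡⟨⟩
    mkℚ (+ m) 0 (coprime-1 m) * mkℚ (+ n) 0 (coprime-1 n) ≡⟨ sym (cong₂ _*_ (ι-mkℚ m) (ι-mkℚ n)) ⟩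
    ι m * ι n                                          ∎

  ι-+ : ∀ m n → ι (m ℕ.+ n) ≡ ι m + ι n
  ι-+ m n = begin
    ι (m ℕ.+ n)                                        ≡⟨ cong (ℚ._/ 1) (trans (ℤ.pos-+ m n) (sym (cong₂ ℤ._+_ (ℤ.*-identityʳ (+ m)) (ℤ.*-identityʳ (+ n))))) ⟩
    (+ m ℤ.* + 1 ℤ.+ + n ℤ.* + 1) ℚ./ 1                ≡⟨⟩
    mkℚ (+ m) 0 (coprime-1 m) + mkℚ (+ n) 0 (coprime-1 n) ≡⟨ sym (cong₂ _+_ (ι-mkℚ m) (ι-mkℚ n)) ⟩
    ι m + ι n                                          ∎

  ι-inverse : ∀ P .{{_ : NonZero P}} → ι P * (+ 1 ℚ./ P) ≡ 1ℚ
  ι-inverse (suc k) = begin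
    ι (suc k) * (+ 1 ℚ./ suc k)                           ≡⟨ cong₂ _*_ (ι-mkℚ (suc k)) (ℚ.normalize-coprime {1} {k} coprime-1-) ⟩
    mkℚ (+ suc k) 0 (coprime-1 (suc k)) * mkℚ (+ 1) k coprime-1-  ≡⟨ ℚ.*-inverseʳ (mkℚ (+ suc k) 0 (coprime-1 (suc k))) ⟩
    1ℚ                                                    ∎
    where
    coprime-1- : Coprime 1 (suc k)
    coprime-1- (d∣1 , _) = ℕ.∣1⇒≡1 d∣1

  -- One step of inclusion–exclusion: if c + c₁ numbers survive a sieve on a range
  -- of length P·R′ and c₁ of them lie in a sub-range counted like a range of
  -- length R′, then c = P·R′ · (1 - 1/P) · Π.
  sieve-step : ∀ P .{{_ : NonZero P}} (R′ c c₁ : ℕ) (Π : ℚ) →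
               ι (c ℕ.+ c₁) ≡ ι (P ℕ.* R′) * Π → ι c₁ ≡ ι R′ * Π →
               ι c ≡ ι (P ℕ.* R′) * ((1ℚ - (+ 1 ℚ./ P)) * Π)
  sieve-step P R′ c c₁ Π total part = begin
    ι c                                          ≡⟨ solve 2 (λ a b → a := (a :+ b) :- b) refl (ι c) (ι c₁) ⟩
    (ι c + ι c₁) - ι c₁                          ≡⟨ cong₂ _-_ (trans (sym (ι-+ c c₁)) total) part ⟩
    ι (P ℕ.* R′) * Π - ι R′ * Π                  ≡⟨ cong (λ z → ι (P ℕ.* R′) * Π - z * Π) (sym (ℚ.*-identityˡ (ι R′))) ⟩
    ι (P ℕ.* R′) * Π - 1ℚ * ι R′ * Π             ≡⟨ cong (λ z → ι (P ℕ.* R′) * Π - z * ι R′ * Π) (sym (ι-inverse P)) ⟩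
    ι (P ℕ.* R′) * Π - (ι P * x) * ι R′ * Π      ≡⟨ cong (λ z → z * Π - (ι P * x) * ι R′ * Π) (ι-* P R′) ⟩
    ι P * ι R′ * Π - (ι P * x) * ι R′ * Π        ≡⟨ ring (ι P) (ι R′) x Π ⟩
    ι P * ι R′ * ((1ℚ - x) * Π)                  ≡⟨ cong (λ z → z * ((1ℚ - x) * Π)) (sym (ι-* P R′)) ⟩
    ι (P ℕ.* R′) * ((1ℚ - x) * Π)                ∎
    where
    x = + 1 ℚ./ P
    ring : ∀ a b x p → a * b * p - (a * x) * b * p ≡ a * b * ((1ℚ - x) * p)
    ring = solve 4 (λ a b x p → a :* b :* p :- (a :* x) :* b :* p := a :* b :* ((con 1ℚ :- x) :* p)) refl

  factorProduct : ℕ → List ℕ → ℚ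
  factorProduct s ps = foldr (λ p acc → factor s p * acc) 1ℚ ps

  factorProduct-split : ∀ s {P Q : Pred ℕ 0ℓ} (P? : Decidable P) (Q? : Decidable Q) xs →
    factorProduct s (filter P? xs) ≡
    factorProduct s (filter (λ p → P? p ×-dec ¬? (Q? p)) xs) * factorProduct s (filter (λ p → P? p ×-dec Q? p) xs)
  factorProduct-split s P? Q? [] = sym (ℚ.*-identityˡ 1ℚ)
  factorProduct-split s P? Q? (x ∷ xs) with P? x | Q? x
  ... | yes _ | yes _ = trans (cong (factor s x *_) (factorProduct-split s P? Q? xs))
                             (solve 3 (λ f a b → f :* (a :* b) := a :* (f :* b)) refl (factor s x) Π¬Q ΠQ)
    where
    Π¬Q = factorProduct s (filter (λ p → P? p ×-dec ¬? (Q? p)) xs)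
    ΠQ = factorProduct s (filter (λ p → P? p ×-dec Q? p) xs)
  ... | yes _ | no _ = trans (cong (factor s x *_) (factorProduct-split s P? Q? xs))
                             (solve 3 (λ f a b → f :* (a :* b) := (f :* a) :* b) refl (factor s x) Π¬Q ΠQ)
    where
    Π¬Q = factorProduct s (filter (λ p → P? p ×-dec ¬? (Q? p)) xs)
    ΠQ = factorProduct s (filter (λ p → P? p ×-dec Q? p) xs)
  ... | no _ | _ = factorProduct-split s P? Q? xs

  ι-positive : ∀ n .{{_ : NonZero n}} → Positive (ι n)
  ι-positive (suc k) = subst Positive (sym (ι-mkℚ (suc k))) _

  -- 1 - 1/P > 0 for P ≥ 2, because 1 - 1/P = (P - 1)·(1/P).
  private
    1-1/P-positive : ∀ P .{{_ : NonZero P}} → 2 ≤ P → Positive (1ℚ - (+ 1 ℚ./ P))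
    1-1/P-positive (suc zero) (s≤s ())
    1-1/P-positive (suc (suc k)) _ =
      subst Positive P-1·x≡1-x (ℚ.pos*pos⇒pos (ι (suc k)) {{ι-positive (suc k)}} x {{ℚ.normalize-pos 1 (suc (suc k))}})
      where
      x = + 1 ℚ./ suc (suc k)
      P-1·x≡1-x : ι (suc k) * x ≡ 1ℚ - x
      P-1·x≡1-x = begin
        ι (suc k) * x              ≡⟨ solve 2 (λ a x → a :* x := (a :+ con 1ℚ) :* x :- x) refl (ι (suc k)) x ⟩
        (ι (suc k) + 1ℚ) * x - x   ≡⟨ cong (λ z → z * x - x) (sym (trans (cong ι (ℕ.+-comm 1 (suc k))) (ι-+ (suc k) 1))) ⟩
        ι (suc (suc k)) * x - x    ≡⟨ cong (_- x) (ι-inverse (suc (suc k))) ⟩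
        1ℚ - x                     ∎

  factor-positive : ∀ s .{{_ : NonZero s}} p → Prime p → Positive (factor s p)
  factor-positive s@(suc _) (suc p′) prime-p =
    1-1/P-positive (suc p′ ^ s) {{ℕ.m^n≢0 (suc p′) s}}
      (ℕ.≤-trans (ℕ.nonTrivial⇒n>1 (suc p′) {{prime⇒nonTrivial prime-p}}) (ℕ.∣⇒≤ {{ℕ.m^n≢0 (suc p′) s}} (ℕ.m∣m*n _)))

  factorProduct-positive : ∀ s .{{_ : NonZero s}} ps → All Prime ps → Positive (factorProduct s ps)
  factorProduct-positive s [] _ = _
  factorProduct-positive s (p ∷ ps) (prime-p ∷ primes) =
    ℚ.pos*pos⇒pos (factor s p) {{factor-positive s p prime-p}} (factorProduct s ps) {{factorProduct-positive s ps primes}}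


module Sieve where

  open import Defs using (_∣ℤ?_; factor)
  open Counting
  open IntegerDivisibility
  open Powers
  open Rationals
  open import Data.Nat as ℕ using (ℕ; NonZero; _^_; _*_)
  open import Data.Nat.Properties using (m^n≢0; m*n≢0; *-assoc; +-comm)
  open import Data.Nat.Divisibility using (_∣_; _∣?_; divides; ∣-trans; n∣m*n; m*n∣⇒m∣; m*n∣⇒n∣)
  open import Data.Nat.Coprimality using (Coprime) renaming (sym to coprime-sym)
  open import Data.Nat.Primality using (Prime; prime⇒nonZero)
  open import Data.Nat.ListAction using (product)
  open import Data.Nat.Tactic.RingSolver using () renaming (solve-∀ to ℕ-solve-∀)
  open import Data.Integer using (ℤ; +_; _-_; _+_) renaming (_*_ to _*ℤ_)
  import Data.Integer.Properties as ℤ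
  open import Data.Integer.Divisibility as ℤ∣ using ()
  open import Data.Integer.Divisibility.Signed using (∣ᵤ⇒∣; ∣⇒∣ᵤ; ∣m+n∣n⇒∣m; ∣m⇒∣m*n; ∣m∣n⇒∣m+n; ∣m∣n⇒∣m-n)
    renaming (_∣_ to _∣ˢ_; ∣-refl to ∣ˢ-refl)
  open import Data.Integer.Tactic.RingSolver using (solve-∀)
  open import Data.Rational as ℚ using (ℚ; 1ℚ)
  import Data.Rational.Properties as ℚ
  open import Data.List using (List; []; _∷_)
  open import Data.List.Relation.Unary.All using (All; []; _∷_; all?)
  open import Data.List.Relation.Unary.AllPairs using (AllPairs; []; _∷_)
  open import Data.Product using (_×_; _,_; proj₁; proj₂; ∃)
  open import Function.Bundles using (_⇔_; mk⇔; Equivalence)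
  open import Relation.Nullary using (¬_)
  open import Relation.Nullary.Decidable using (_×-dec_; ¬?)
  open import Relation.Unary using (Decidable)
  open import Relation.Binary.PropositionalEquality
  open ≡-Reasoning

  crt : ∀ K P → Coprime K P → (c : ℤ) →
        ∃ λ c′ → ∀ y → ((+ K) ℤ∣.∣ (+ y - c) × P ∣ y) ⇔ ((+ (K * P)) ℤ∣.∣ (+ y - c′))
  crt K P cop c = c′ , λ y → mk⇔ (merge y) (λ h → unmergeK y h , unmergeP y h)
    where
    u = proj₁ (inverse-mod (+ P) K (coprime-sym cop))
    Pu≡1 : (+ K) ∣ˢ (+ P *ℤ u - + 1)
    Pu≡1 = proj₂ (inverse-mod (+ P) K (coprime-sym cop))
    c′ : ℤ
    c′ = + P *ℤ u *ℤ c
    P∣c′ : (+ P) ∣ˢ c′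
    P∣c′ = subst (+ P ∣ˢ_) (sym (ℤ.*-assoc (+ P) u c)) (∣m⇒∣m*n (u *ℤ c) ∣ˢ-refl)
    -- y - c = (y - c′) + (P·u - 1)·c, and (P·u - 1)·c ≡ 0 (mod K).
    shift : ∀ y → + y - c ≡ (+ y - c′) + (+ P *ℤ u - + 1) *ℤ c
    shift y = ring (+ y) c (+ P) u
      where
      ring : ∀ y c p u → y - c ≡ (y - p *ℤ u *ℤ c) + (p *ℤ u - + 1) *ℤ c
      ring = solve-∀
    K∣[Pu-1]c : (+ K) ∣ˢ ((+ P *ℤ u - + 1) *ℤ c)
    K∣[Pu-1]c = ∣m⇒∣m*n c Pu≡1
    merge : ∀ y → (+ K) ℤ∣.∣ (+ y - c) × P ∣ y → (+ (K * P)) ℤ∣.∣ (+ y - c′)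
    merge y (K∣y-c , P∣y) = coprime-*-∣ cop (∣⇒∣ᵤ {+ K} {+ y - c′} K∣y-c′) (∣⇒∣ᵤ {+ P} {+ y - c′} P∣y-c′)
      where
      K∣y-c′ = ∣m+n∣n⇒∣m (subst (+ K ∣ˢ_) (shift y) (∣ᵤ⇒∣ {+ K} {+ y - c} K∣y-c)) K∣[Pu-1]c
      P∣y-c′ = ∣m∣n⇒∣m-n (∣ᵤ⇒∣ {+ P} {+ y} P∣y) P∣c′
    unmergeK : ∀ y → (+ (K * P)) ℤ∣.∣ (+ y - c′) → (+ K) ℤ∣.∣ (+ y - c)
    unmergeK y KP∣ = ∣⇒∣ᵤ {+ K} {+ y - c} (subst (+ K ∣ˢ_) (sym (shift y))
      (∣m∣n⇒∣m+n (∣ᵤ⇒∣ {+ K} {+ y - c′} (m*n∣⇒m∣ K P KP∣)) K∣[Pu-1]c))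
    unmergeP : ∀ y → (+ (K * P)) ℤ∣.∣ (+ y - c′) → P ∣ y
    unmergeP y KP∣ = ∣⇒∣ᵤ {+ P} {+ y} (subst (+ P ∣ˢ_) (ring (+ y) c′)
      (∣m∣n⇒∣m+n (∣ᵤ⇒∣ {+ P} {+ y - c′} (m*n∣⇒n∣ K P KP∣)) P∣c′))
      where
      ring : ∀ y c → (y - c) + c ≡ y
      ring = solve-∀

  SurvivesSieve : ℕ → List ℕ → ℕ → Set
  SurvivesSieve s ps y = All (λ p → ¬ (p ^ s ∣ y)) ps

  survivesSieve? : ∀ s ps → Decidable (SurvivesSieve s ps)
  survivesSieve? s ps y = all? (λ p → ¬? ((p ^ s) ∣? y)) ps

  sievedClass : ℕ → List ℕ → (K : ℕ) → ℤ → ℕ → ℕ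
  sievedClass s ps K c R = count (λ y → ((+ K) ∣ℤ? (+ y - c)) ×-dec survivesSieve? s ps y) (K * R)

  private
    coprime-after-merge : ∀ s {p K} (ps : List ℕ) → Prime p → All Prime ps → All (p ≢_) ps →
                          All (λ q → Coprime q K) ps → All (λ q → Coprime q (K * p ^ s)) ps
    coprime-after-merge s [] _ _ _ _ = []
    coprime-after-merge s (q ∷ ps) prime-p (prime-q ∷ primes) (p≢q ∷ distinct) (cop ∷ cops) =
      coprime-* cop (coprime-^ʳ s (distinct-primes-coprime prime-q prime-p (λ q≡p → p≢q (sym q≡p))))
      ∷ coprime-after-merge s ps prime-p primes distinct cops

  -- For p ∷ ps, write P = p^s and R = P·R′.
  -- The survivors of ps in the class split into those with P ∤ y (the survivors
  -- of p ∷ ps) and those with P ∣ y, which by the CRT form the survivors of ps in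
  -- a single class modulo K·P below (K·P)·R′; the induction hypothesis counts both.
  sieve : ∀ s .{{_ : NonZero s}} (ps : List ℕ) (K : ℕ) .{{_ : NonZero K}} (c : ℤ) (R : ℕ) →
          All Prime ps → AllPairs _≢_ ps → All (λ p → Coprime p K) ps → product ps ^ s ∣ R →
          ι (sievedClass s ps K c R) ≡ ι R ℚ.* factorProduct s ps
  sieve s [] K c R _ _ _ _ = begin
    ι (sievedClass s [] K c R)                          ≡⟨ cong ι (count-cong _ (λ y → (+ K) ∣ℤ? (+ y - c)) (K * R) (λ _ _ → proj₁) (λ _ _ h → h , [])) ⟩
    ι (count (λ y → (+ K) ∣ℤ? (+ y - c)) (K * R))       ≡⟨ cong ι (count-residueClass K c R) ⟩
    ι R                                                  ≡⟨ sym (ℚ.*-identityʳ (ι R)) ⟩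
    ι R ℚ.* 1ℚ                                           ∎
  sieve s (p ∷ ps) K c R (prime-p ∷ primes) (p∉ps ∷ distinct) (cop ∷ cops) (divides w R≡w·Π^s) = begin
    ι (sievedClass s (p ∷ ps) K c R)                    ≡⟨ cong ι notMultiples≡ ⟩
    ι notMultiples                                       ≡⟨ sieve-step P R′ notMultiples multiples (factorProduct s ps) total multiplesCount ⟩
    ι (P * R′) ℚ.* ((1ℚ ℚ.- (+ 1 ℚ./ P)) ℚ.* factorProduct s ps)
                                                         ≡⟨ cong₂ ℚ._*_ (cong ι (sym R≡PR′)) (cong (ℚ._* factorProduct s ps) (1-p^-s p)) ⟩
    ι R ℚ.* factorProduct s (p ∷ ps)                     ∎
    where
    P = p ^ s
    instance
      p≢0 : NonZero p
      p≢0 = prime⇒nonZero prime-p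
      P≢0 : NonZero P
      P≢0 = m^n≢0 p s
      KP≢0 : NonZero (K * P)
      KP≢0 = m*n≢0 K P
    Π = product ps
    R′ = w * Π ^ s
    R≡PR′ : R ≡ P * R′
    R≡PR′ = trans R≡w·Π^s (trans (cong (w *_) (^-distribʳ-* p Π s)) (ring w P (Π ^ s)))
      where
      ring : ∀ a b d → a * (b * d) ≡ b * (a * d)
      ring = ℕ-solve-∀
    Π^s∣R′ : Π ^ s ∣ R′
    Π^s∣R′ = n∣m*n w
    Π^s∣R : Π ^ s ∣ R
    Π^s∣R = subst (Π ^ s ∣_) (sym R≡PR′) (∣-trans Π^s∣R′ (n∣m*n P))
    open Equivalence
    c′ = proj₁ (crt K P (coprime-^ʳ s (coprime-sym cop)) c)
    crt-c′ = proj₂ (crt K P (coprime-^ʳ s (coprime-sym cop)) c)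
    inClass? = λ y → ((+ K) ∣ℤ? (+ y - c)) ×-dec survivesSieve? s ps y
    notMultiples = count (λ y → inClass? y ×-dec ¬? (P ∣? y)) (K * R)
    multiples = count (λ y → inClass? y ×-dec (P ∣? y)) (K * R)
    notMultiples≡ : sievedClass s (p ∷ ps) K c R ≡ notMultiples
    notMultiples≡ = count-cong _ _ (K * R)
      (λ { _ _ (K∣ , P∤y ∷ survives) → (K∣ , survives) , P∤y })
      (λ { _ _ ((K∣ , survives) , P∤y) → K∣ , P∤y ∷ survives })
    multiples≡ : multiples ≡ sievedClass s ps (K * P) c′ R′
    multiples≡ = trans
      (count-cong _ _ (K * R)
        (λ { y _ ((K∣ , survives) , P∣y) → to (crt-c′ y) (K∣ , P∣y) , survives })
        (λ { y _ (KP∣ , survives) → (proj₁ (from (crt-c′ y) KP∣) , survives) , proj₂ (from (crt-c′ y) KP∣) }))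
      (cong (count _) (trans (cong (K *_) R≡PR′) (sym (*-assoc K P R′))))
    multiplesCount : ι multiples ≡ ι R′ ℚ.* factorProduct s ps
    multiplesCount = trans (cong ι multiples≡)
      (sieve s ps (K * P) c′ R′ primes distinct (coprime-after-merge s ps prime-p primes p∉ps cops) Π^s∣R′)
    total : ι (notMultiples ℕ.+ multiples) ≡ ι (P * R′) ℚ.* factorProduct s ps
    total = begin
      ι (notMultiples ℕ.+ multiples)            ≡⟨ cong ι (+-comm notMultiples multiples) ⟩
      ι (multiples ℕ.+ notMultiples)            ≡⟨ cong ι (sym (count-split inClass? (P ∣?_) (K * R))) ⟩
      ι (sievedClass s ps K c R)                ≡⟨ sieve s ps K c R primes distinct cops Π^s∣R ⟩
      ι R ℚ.* factorProduct s ps                ≡⟨ cong (λ z → ι z ℚ.* factorProduct s ps) R≡PR′ ⟩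
      ι (P * R′) ℚ.* factorProduct s ps         ∎
    1-p^-s : ∀ p .{{_ : NonZero p}} → 1ℚ ℚ.- (+ 1 ℚ./ p ^ s) {{m^n≢0 p s}} ≡ factor s p
    1-p^-s (ℕ.suc _) = refl


module PrimeLists where

  open Powers
  open import Data.Nat using (ℕ; zero; suc; _+_; _<_)
  open import Data.Nat.Properties using (+-identityʳ; +-suc; <-irrefl; ≤-trans; m≤m+n)
  open import Data.Nat.Divisibility using (_∣_; 1∣_; ∣1⇒≡1)
  open import Data.Nat.Coprimality using (Coprime)
  open import Data.Nat.Primality using (Prime)
  open import Data.Nat.ListAction using (product)
  open import Data.List using (List; []; _∷_; filter; upTo; _++_; [_])
  import Data.List.Properties as List
  open import Data.List.Relation.Unary.All using (All; []; _∷_)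
  open import Data.List.Relation.Unary.AllPairs using (AllPairs; []; _∷_)
  open import Data.Product using (_,_)
  open import Relation.Unary using (Pred; Decidable)
  open import Level using (0ℓ)
  open import Relation.Binary.PropositionalEquality hiding ([_])
  open ≡-Reasoning

  coprime-product : ∀ {p} ps → Prime p → All Prime ps → All (p ≢_) ps → Coprime p (product ps)
  coprime-product [] _ _ _ (_ , d∣1) = ∣1⇒≡1 d∣1
  coprime-product (q ∷ ps) prime-p (prime-q ∷ primes) (p≢q ∷ distinct) =
    coprime-* (distinct-primes-coprime prime-p prime-q p≢q) (coprime-product ps prime-p primes distinct)

  product-∣ : ∀ {d} ps → All Prime ps → AllPairs _≢_ ps → All (_∣ d) ps → product ps ∣ d
  product-∣ [] _ _ _ = 1∣ _
  product-∣ (p ∷ ps) (prime-p ∷ primes) (p∉ps ∷ distinct) (p∣d ∷ ps∣d) =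
    coprime-*-∣ (coprime-product ps prime-p primes p∉ps) p∣d (product-∣ ps primes distinct ps∣d)

  filter-upTo-beyond : ∀ {P : Pred ℕ 0ℓ} (P? : Decidable P) k j → (∀ x → P x → x < k) →
                       filter P? (upTo (k + j)) ≡ filter P? (upTo k)
  filter-upTo-beyond P? k zero bound = cong (λ z → filter P? (upTo z)) (+-identityʳ k)
  filter-upTo-beyond P? k (suc j) bound = begin
    filter P? (upTo (k + suc j))                ≡⟨ cong (λ z → filter P? (upTo z)) (+-suc k j) ⟩
    filter P? (upTo (suc (k + j)))              ≡⟨ cong (filter P?) (sym (List.upTo-∷ʳ (k + j))) ⟩
    filter P? (upTo (k + j) ++ [ k + j ])                ≡⟨ List.filter-++ P? (upTo (k + j)) [ k + j ] ⟩
    filter P? (upTo (k + j)) ++ filter P? [ k + j ]      ≡⟨ cong (filter P? (upTo (k + j)) ++_) (List.filter-reject P? {xs = []} k+j-rejected) ⟩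
    filter P? (upTo (k + j)) ++ []                       ≡⟨ List.++-identityʳ _ ⟩
    filter P? (upTo (k + j))                             ≡⟨ filter-upTo-beyond P? k j bound ⟩
    filter P? (upTo k)                                   ∎
    where
    k+j-rejected = λ P[k+j] → <-irrefl refl (≤-trans (bound _ P[k+j]) (m≤m+n k j))

module RestrictedCongruence (a b : ℤ) (n s t : ℕ) .{{_ : NonZero n}} .{{_ : NonZero s}} .{{_ : NonZero t}}
                            (t∣n : t ∣ n) where

  open import Defs
  open Counting
  open IntegerDivisibility
  open Powers
  open GeneralizedGcd
  open Rationals
  open Sieve
  open PrimeLists
  open import Data.Nat as ℕ using (ℕ; zero; suc; NonZero; _^_; _*_; _/_; s≤s; z≤n; ≢-nonZero; ≢-nonZero⁻¹; >-nonZero; >-nonZero⁻¹)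
  open import Data.Nat.Properties
  open import Data.Nat.Divisibility using (_∣_; ∣-trans; m∣m*n; n∣m*n; ∣m⇒∣m*n; ∣n⇒∣m*n; ∣1⇒≡1; 0∣⇒≡0; *-monoʳ-∣; *-cancelˡ-∣; ∣-antisym; _∣?_; ∣⇒≤)
  open import Data.Nat.DivMod using (m*[n/m]≡n; m*n/n≡m)
  open import Data.Nat.GCD using (gcd-comm)
  open import Data.Nat.Tactic.RingSolver using () renaming (solve-∀ to ℕ-solve-∀)
  open import Data.Nat.Coprimality using (Coprime; coprime-divisor) renaming (sym to coprime-sym)
  open import Data.Nat.Primality using (Prime; prime?; euclidsLemma)
  open import Data.Integer as ℤ using (ℤ; +_; _/ℕ_) renaming (∣_∣ to abs)
  import Data.Integer.Properties as ℤ
  import Data.Integer.Divisibility as ℤ∣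
  open import Data.Integer.Divisibility.Signed using (∣⇒∣ᵤ)
  open import Data.Integer.Tactic.RingSolver using (solve-∀)
  open import Data.Product using (_×_; _,_; proj₁; proj₂; ∃-syntax)
  open import Data.Empty using (⊥-elim)
  open import Function.Bundles using (_⇔_; mk⇔; Equivalence)
  open import Relation.Nullary using (¬_; yes; no)
  open import Relation.Nullary.Decidable using (_×-dec_; ¬?)
  open import Relation.Unary using (Decidable)
  open import Data.Sum using (inj₁; inj₂)
  open import Data.Rational as ℚ using ()
  import Data.Rational.Properties as ℚ
  open import Data.Rational.Solver using (module +-*-Solver)
  open +-*-Solver using (solve; _:*_; _:=_)
  open import Data.Nat.ListAction using (product)
  open import Data.List using (List; []; _∷_; filter; upTo; length)
  import Data.List.Properties as List
  open import Data.List.Relation.Unary.All as All using (All; []; _∷_)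
  open import Data.List.Relation.Unary.All.Properties using (all-filter)
  open import Data.List.Relation.Unary.AllPairs using (AllPairs)
  import Data.List.Relation.Unary.Unique.Propositional.Properties as Unique
  open import Data.List.Membership.Propositional.Properties using (∈-filter⁺; ∈-upTo⁺)
  open import Relation.Binary.PropositionalEquality hiding (J)
  open ≡-Reasoning

  m : ℕ
  m = n / t

  n≡tm : n ≡ t * m
  n≡tm = sym (m*[n/m]≡n t∣n)

  instance
    m≢0 : NonZero m
    m≢0 = ≢-nonZero (λ m≡0 → ≢-nonZero⁻¹ n (trans n≡tm (trans (cong (t *_) m≡0) (*-zeroʳ t))))

  T M N : ℕ
  T = t ^ s
  M = m ^ s
  N = n ^ s

  instance
    T≢0 : NonZero T
    T≢0 = m^n≢0 t s
    M≢0 : NonZero M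
    M≢0 = m^n≢0 m s
    N≢0 : NonZero N
    N≢0 = m^n≢0 n s

  N≡TM : N ≡ T * M
  N≡TM = trans (cong (_^ s) n≡tm) (^-distribʳ-* t m s)

  N/T≡M : _/_ N T ≡ M
  N/T≡M = trans (cong (_/ T) N≡TM) (trans (cong (_/ T) (*-comm T M)) (m*n/n≡m M T))

  A : ℤ
  A = a ℤ.^ s

  module GcdWith (Y : ℕ) .{{_ : NonZero Y}} (x : ℤ) =
    GenGcdBase s x (+ Y) (>-nonZero (≤-trans (>-nonZero⁻¹ Y) (m≤n+m Y (abs x))))

  -- y is "s-power-coprime" to m: no prime p ∣ m has p^s ∣ y, i.e. (y, m^s)_s = 1.
  PowerCoprime : ℕ → Set
  PowerCoprime y = ∀ p → Prime p → p ∣ m → ¬ (p ^ s ∣ y)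

  -- Then no k ∣ m other than 1 has k^s ∣ y: a prime factor of k would contradict it.
  powerCoprime⇒trivial : ∀ {y} → PowerCoprime y → ∀ k → k ∣ m → k ^ s ∣ y → k ≡ 1
  powerCoprime⇒trivial coprime zero 0∣m _ = ⊥-elim (≢-nonZero⁻¹ m (0∣⇒≡0 0∣m))
  powerCoprime⇒trivial coprime 1 _ _ = refl
  powerCoprime⇒trivial coprime k@(suc (suc _)) k∣m k^s∣y with prime-divisor k (s≤s (s≤s z≤n))
  ... | p , prime-p , p∣k = ⊥-elim (coprime p prime-p (∣-trans p∣k k∣m) (∣-trans (^-monoˡ-∣ s p∣k) k^s∣y))

  powerCoprime-cancel : ∀ L X {Y} .{{_ : NonZero L}} → L ∣ m → L ^ s ∣ X ^ s * Y → PowerCoprime Y → L ∣ X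
  powerCoprime-cancel L X {Y} L∣m L^s∣X^sY Y-coprime = cofactor≡1⇒∣ split L₁≡1
    where
    split = gcdSplit L X
    open GcdSplit split renaming (k₁ to L₁; l₁ to X₁; k≡gk₁ to L≡gL₁; l≡gl₁ to X≡gX₁)
    instance
      g^s≢0 : NonZero (g ^ s)
      g^s≢0 = m^n≢0 g s {{g≢0}}
    g^sL₁^s∣g^sX₁^sY : g ^ s * L₁ ^ s ∣ g ^ s * (X₁ ^ s * Y)
    g^sL₁^s∣g^sX₁^sY = subst₂ _∣_ (trans (cong (_^ s) L≡gL₁) (^-distribʳ-* g L₁ s))
      (trans (cong (λ z → z ^ s * Y) X≡gX₁) (trans (cong (_* Y) (^-distribʳ-* g X₁ s)) (*-assoc (g ^ s) (X₁ ^ s) Y)))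
      L^s∣X^sY
    L₁^s∣Y : L₁ ^ s ∣ Y
    L₁^s∣Y = coprime-divisor (coprime-^ s coprime) (*-cancelˡ-∣ (g ^ s) g^sL₁^s∣g^sX₁^sY)
    L₁≡1 : L₁ ≡ 1
    L₁≡1 = powerCoprime⇒trivial Y-coprime L₁ (∣-trans (subst (L₁ ∣_) (sym L≡gL₁) (n∣m*n g)) L∣m) L₁^s∣Y

  restriction⇒T∣x : ∀ x → genGcd s x (+ N) ≡ T → T ∣ abs x
  restriction⇒T∣x x restricted = subst (_∣ abs x) restricted (GcdWith.L^s∣a N x)

  restriction⇒powerCoprime : ∀ y → genGcd s (+ (T * y)) (+ N) ≡ T → PowerCoprime y
  restriction⇒powerCoprime y restricted p prime-p p∣m p^s∣y =
    prime⇒≢1 prime-p (∣1⇒≡1 (*-cancelˡ-∣ t (subst (t * p ∣_) (trans L≡t (sym (*-identityʳ t))) tp∣L)))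
    where
    open GcdWith N (+ (T * y))
    L≡t : L ≡ t
    L≡t = ^-injectiveˡ s restricted
    tp∣L : t * p ∣ L
    tp∣L = L-greatest (t * p) (subst (_∣ T * y) (sym (^-distribʳ-* t p s)) (*-monoʳ-∣ T p^s∣y))
                              (^-monoˡ-∣ s (subst (t * p ∣_) (sym n≡tm) (*-monoʳ-∣ t p∣m)))

  powerCoprime⇒restriction : ∀ y → PowerCoprime y → genGcd s (+ (T * y)) (+ N) ≡ T
  powerCoprime⇒restriction y coprime = cong (_^ s) L≡t
    where
    open GcdWith N (+ (T * y))
    t∣L : t ∣ L
    t∣L = L-greatest t (m∣m*n y) (subst (T ∣_) (sym N≡TM) (m∣m*n M))
    L′ = _∣_.quotient t∣L
    L≡L′t : L ≡ L′ * t
    L≡L′t = _∣_.equality t∣L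
    L^s≡TL′^s : L ^ s ≡ T * L′ ^ s
    L^s≡TL′^s = trans (cong (_^ s) L≡L′t) (trans (^-distribʳ-* L′ t s) (*-comm (L′ ^ s) T))
    L′≡1 : L′ ≡ 1
    L′≡1 = powerCoprime⇒trivial coprime L′
      (^-cancel-∣ s (*-cancelˡ-∣ T (subst₂ _∣_ L^s≡TL′^s N≡TM L^s∣b)))
      (*-cancelˡ-∣ T (subst (_∣ T * y) L^s≡TL′^s L^s∣a))
    L≡t : L ≡ t
    L≡t = trans L≡L′t (trans (cong (_* t) L′≡1) (*-identityˡ t))

  reduce-congruence : ∀ (Y b′ : ℤ) → b ≡ b′ ℤ.* + T →
                      ((+ N) ℤ∣.∣ (A ℤ.* (Y ℤ.* + T) ℤ.- b)) ⇔ ((+ M) ℤ∣.∣ (A ℤ.* Y ℤ.- b′))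
  reduce-congruence Y b′ b≡b′T =
    mk⇔ (λ N∣ → *-cancelˡ-∣ T (subst₂ _∣_ N≡TM factor-T N∣))
        (λ M∣ → subst₂ _∣_ (sym N≡TM) (sym factor-T) (*-monoʳ-∣ T M∣))
    where
    factor-T : abs (A ℤ.* (Y ℤ.* + T) ℤ.- b) ≡ T * abs (A ℤ.* Y ℤ.- b′)
    factor-T = trans (cong abs (trans (cong (λ v → A ℤ.* (Y ℤ.* + T) ℤ.- v) b≡b′T) (ring A Y b′ (+ T))))
                     (ℤ.abs-* (+ T) _)
      where
      ring : ∀ a y c t → a ℤ.* (y ℤ.* t) ℤ.- c ℤ.* t ≡ t ℤ.* (a ℤ.* y ℤ.- c)
      ring = solve-∀

  solution⇒T∣b : ∀ x → IsSol s a b n t x → T ∣ abs b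
  solution⇒T∣b x (N∣Ax-b , restricted) =
    ∣-difference⇒∣ʳ T (A ℤ.* x) b
      (subst (T ∣_) (sym (ℤ.abs-* A x)) (∣n⇒∣m*n (abs A) (restriction⇒T∣x x restricted)))
      (∣-trans (m∣m*n M) (subst (_∣ abs (A ℤ.* x ℤ.- b)) N≡TM N∣Ax-b))

  -- For the reduced congruence A·Y ≡ b′ (mod M) with Y s-power-coprime to m, the
  -- generalized gcds (A, M)_s and (b′, M)_s agree: a common s-th power divisor of
  -- A and M divides b′ = A·Y - (A·Y - b′), and conversely one of b′ and M divides
  -- A·Y = |a|^s·Y, hence A by powerCoprime-cancel.
  reduced-gcds-agree : ∀ Y b′ → (+ M) ℤ∣.∣ (A ℤ.* Y ℤ.- b′) → PowerCoprime (abs Y) →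
                       genGcd s A (+ M) ≡ genGcd s b′ (+ M)
  reduced-gcds-agree Y b′ M∣AY-b′ Y-coprime = cong (_^ s) (∣-antisym L₁∣L₂ L₂∣L₁)
    where
    module G₁ = GcdWith M A
    module G₂ = GcdWith M b′
    L₁∣L₂ : G₁.L ∣ G₂.L
    L₁∣L₂ = G₂.L-greatest G₁.L
      (∣-difference⇒∣ʳ (G₁.L ^ s) (A ℤ.* Y) b′
        (subst (G₁.L ^ s ∣_) (sym (ℤ.abs-* A Y)) (∣m⇒∣m*n (abs Y) G₁.L^s∣a))
        (∣-trans G₁.L^s∣b M∣AY-b′))
      G₁.L^s∣b
    L₂^s∣|a|^sY : G₂.L ^ s ∣ abs a ^ s * abs Y
    L₂^s∣|a|^sY = subst (G₂.L ^ s ∣_) (trans (ℤ.abs-* A Y) (cong (_* abs Y) (abs-^ a s)))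
      (∣-difference⇒∣ˡ (G₂.L ^ s) (A ℤ.* Y) b′ (∣-trans G₂.L^s∣b M∣AY-b′) G₂.L^s∣a)
    L₂∣L₁ : G₂.L ∣ G₁.L
    L₂∣L₁ = G₁.L-greatest G₂.L
      (subst (G₂.L ^ s ∣_) (sym (abs-^ a s))
        (^-monoˡ-∣ s (powerCoprime-cancel G₂.L (abs a) (^-cancel-∣ s G₂.L^s∣b) L₂^s∣|a|^sY Y-coprime)))
      G₂.L^s∣b

  Conditions : Set
  Conditions = (T ∣ genGcd s b (+ N)) × (genGcd s A (+ (N / T)) ≡ genGcd s (b /ℕ T) (+ (N / T)))

  -- Necessity: write x = Y·T, b = b′·T and use the reduced congruence.
  necessary : ∀ x → IsSol s a b n t x → Conditions
  necessary x sol@(N∣Ax-b , restricted) = T∣gcd , subst (λ z → genGcd s A (+ z) ≡ genGcd s b′ (+ z)) (sym N/T≡M) gcds-agree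
    where
    T∣b = solution⇒T∣b x sol
    T∣x = restriction⇒T∣x x restricted
    T∣gcd : T ∣ genGcd s b (+ N)
    T∣gcd = ^-monoˡ-∣ s (GcdWith.L-greatest N b t T∣b (subst (T ∣_) (sym N≡TM) (m∣m*n M)))
    b′ = b /ℕ T
    Y = x /ℕ T
    x≡YT : x ≡ Y ℤ.* + T
    x≡YT = exact-division x T T∣x
    reduced : (+ M) ℤ∣.∣ (A ℤ.* Y ℤ.- b′)
    reduced = Equivalence.to (reduce-congruence Y b′ (exact-division b T T∣b))
                (subst (λ z → (+ N) ℤ∣.∣ (A ℤ.* z ℤ.- b)) x≡YT N∣Ax-b)
    |x|≡T|Y| : abs x ≡ T * abs Y
    |x|≡T|Y| = trans (cong abs x≡YT) (trans (ℤ.abs-* Y (+ T)) (*-comm (abs Y) T))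
    gcds-agree : genGcd s A (+ M) ≡ genGcd s b′ (+ M)
    gcds-agree = reduced-gcds-agree Y b′ reduced
      (restriction⇒powerCoprime (abs Y) (subst (λ z → genGcd s (+ z) (+ N) ≡ T) |x|≡T|Y| restricted))

  -- The
  -- second condition makes d^s = (b′, M)_s as well, which is what excludes the
  -- primes dividing q from the restriction.
  module SolutionCount (T∣gcd : T ∣ genGcd s b (+ N)) (gcds : genGcd s A (+ (N / T)) ≡ genGcd s (b /ℕ T) (+ (N / T)))
                       (d : ℕ) .{{_ : NonZero d}} (d^s≡ : d ^ s ≡ genGcd s A (+ (N / T))) where

    b′ : ℤ
    b′ = b /ℕ T

    b≡b′T : b ≡ b′ ℤ.* + T
    b≡b′T = exact-division b T (∣-trans T∣gcd (GcdWith.L^s∣a N b))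

    D : ℕ
    D = d ^ s

    instance
      D≢0 : NonZero D
      D≢0 = m^n≢0 d s

    module G₁ = GcdWith M A
    module G₂ = GcdWith M b′

    D≡L₁^s : D ≡ G₁.L ^ s
    D≡L₁^s = trans d^s≡ (cong (λ z → genGcd s A (+ z)) N/T≡M)

    d≡L₂ : d ≡ G₂.L
    d≡L₂ = ^-injectiveˡ s (trans D≡L₁^s (subst (λ z → genGcd s A (+ z) ≡ genGcd s b′ (+ z)) N/T≡M gcds))

    -- d = gcd(|a|, m); write m = d·q and |a| = d·a₁ with q, a₁ coprime.
    open GcdSplit (gcdSplit m (abs a)) renaming (g to g₀; k₁ to q; l₁ to a₁; k≡gk₁ to m≡g₀q; l≡gl₁ to |a|≡g₀a₁; coprime to q⊥a₁)

    -- d is that gcd, since d^s = (A, M)_s = gcd(|a|, m)^s.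
    d≡g₀ : d ≡ g₀
    d≡g₀ = ^-injectiveˡ s (trans D≡L₁^s (cong (_^ s) (trans (genGcdBase-^ s a m) (gcd-comm (abs a) m))))

    m≡dq : m ≡ d * q
    m≡dq = trans m≡g₀q (cong (_* q) (sym d≡g₀))

    |a|≡da₁ : abs a ≡ d * a₁
    |a|≡da₁ = trans |a|≡g₀a₁ (cong (_* a₁) (sym d≡g₀))

    instance
      q≢0 : NonZero q
      q≢0 = ≢-nonZero (λ q≡0 → ≢-nonZero⁻¹ m (trans m≡dq (trans (cong (d *_) q≡0) (*-zeroʳ d))))

    K : ℕ
    K = q ^ s

    instance
      K≢0 : NonZero K
      K≢0 = m^n≢0 q s

    n/dt≡q : _/_ n (d * t) {{m*n≢0 d t}} ≡ q
    n/dt≡q = trans (cong (λ z → _/_ z (d * t) {{m*n≢0 d t}}) (trans n≡tm (trans (cong (t *_) m≡dq) (regroup t d q))))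
                   (m*n/n≡m q (d * t) {{m*n≢0 d t}})
      where
      regroup : ∀ x y z → x * (y * z) ≡ z * (y * x)
      regroup = ℕ-solve-∀

    M≡DK : M ≡ D * K
    M≡DK = trans (cong (_^ s) m≡dq) (^-distribʳ-* d q s)

    |A|≡Da₁^s : abs A ≡ D * a₁ ^ s
    |A|≡Da₁^s = trans (abs-^ a s) (trans (cong (_^ s) |a|≡da₁) (^-distribʳ-* d a₁ s))

    A′ B″ : ℤ
    A′ = A /ℕ D
    B″ = b′ /ℕ D

    A≡A′D : A ≡ A′ ℤ.* + D
    A≡A′D = exact-division A D (subst (_∣ abs A) (sym D≡L₁^s) G₁.L^s∣a)

    b′≡B″D : b′ ≡ B″ ℤ.* + D
    b′≡B″D = exact-division b′ D (subst (λ z → z ^ s ∣ abs b′) (sym d≡L₂) G₂.L^s∣a)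

    A′⊥K : Coprime (abs A′) K
    A′⊥K = subst (λ z → Coprime z K) (sym |A′|≡a₁^s) (coprime-^ s (coprime-sym q⊥a₁))
      where
      |A′|≡a₁^s : abs A′ ≡ a₁ ^ s
      |A′|≡a₁^s = *-cancelʳ-≡ (abs A′) (a₁ ^ s) D
        (trans (sym (trans (cong abs A≡A′D) (ℤ.abs-* A′ (+ D)))) (trans |A|≡Da₁^s (*-comm D _)))

    -- With u the inverse of A′ modulo K, the solutions form the class of y₀ = u·B″.
    u y₀ : ℤ
    u = proj₁ (inverse-mod A′ K A′⊥K)
    y₀ = u ℤ.* B″

    reduced⇔class : ∀ Y → ((+ M) ℤ∣.∣ (A ℤ.* Y ℤ.- b′)) ⇔ ((+ K) ℤ∣.∣ (Y ℤ.- y₀))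
    reduced⇔class Y = mk⇔ to from
      where
      X = A′ ℤ.* Y ℤ.- B″
      -- A·Y - b′ = D·X and X = A′·(Y - y₀) + (A′·u - 1)·B″, with K ∣ A′·u - 1.
      |AY-b′|≡D|X| : abs (A ℤ.* Y ℤ.- b′) ≡ D * abs X
      |AY-b′|≡D|X| = trans (cong abs (trans (cong₂ (λ p r → p ℤ.* Y ℤ.- r) A≡A′D b′≡B″D) (ring A′ Y B″ (+ D))))
                           (ℤ.abs-* (+ D) X)
        where
        ring : ∀ a y c e → a ℤ.* e ℤ.* y ℤ.- c ℤ.* e ≡ e ℤ.* (a ℤ.* y ℤ.- c)
        ring = solve-∀
      X≡ : X ≡ A′ ℤ.* (Y ℤ.- y₀) ℤ.+ (A′ ℤ.* u ℤ.- + 1) ℤ.* B″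
      X≡ = ring A′ Y B″ u
        where
        ring : ∀ a y c u → a ℤ.* y ℤ.- c ≡ a ℤ.* (y ℤ.- u ℤ.* c) ℤ.+ (a ℤ.* u ℤ.- + 1) ℤ.* c
        ring = solve-∀
      K∣[A′u-1]B″ : K ∣ abs ((A′ ℤ.* u ℤ.- + 1) ℤ.* B″)
      K∣[A′u-1]B″ = subst (K ∣_) (sym (ℤ.abs-* (A′ ℤ.* u ℤ.- + 1) B″))
        (∣m⇒∣m*n (abs B″) (∣⇒∣ᵤ {+ K} {A′ ℤ.* u ℤ.- + 1} (proj₂ (inverse-mod A′ K A′⊥K))))
      to : (+ M) ℤ∣.∣ (A ℤ.* Y ℤ.- b′) → (+ K) ℤ∣.∣ (Y ℤ.- y₀)
      to M∣ = coprime-divisor (coprime-sym A′⊥K) (subst (K ∣_) (ℤ.abs-* A′ (Y ℤ.- y₀))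
        (∣-+⇒∣ˡ K (A′ ℤ.* (Y ℤ.- y₀)) ((A′ ℤ.* u ℤ.- + 1) ℤ.* B″) (subst (K ∣_) (cong abs X≡) (*-cancelˡ-∣ D (subst₂ _∣_ M≡DK |AY-b′|≡D|X| M∣))) K∣[A′u-1]B″))
      from : (+ K) ℤ∣.∣ (Y ℤ.- y₀) → (+ M) ℤ∣.∣ (A ℤ.* Y ℤ.- b′)
      from K∣ = subst₂ _∣_ (sym M≡DK) (sym |AY-b′|≡D|X|) (*-monoʳ-∣ D (subst (K ∣_) (cong abs (sym X≡))
        (∣-+ K (A′ ℤ.* (Y ℤ.- y₀)) ((A′ ℤ.* u ℤ.- + 1) ℤ.* B″) (subst (K ∣_) (sym (ℤ.abs-* A′ (Y ℤ.- y₀))) (∣n⇒∣m*n (abs A′) K∣)) K∣[A′u-1]B″)))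

    -- Under the reduced congruence no prime p ∣ q has p^s ∣ Y: otherwise (d·p)^s
    -- would divide A·Y and M, hence b′, and so d·p ∣ (b′, M)_s-base = d.
    reduced⇒q-powerCoprime : ∀ Y → (+ M) ℤ∣.∣ (A ℤ.* Y ℤ.- b′) → ∀ p → Prime p → p ∣ q → ¬ (p ^ s ∣ abs Y)
    reduced⇒q-powerCoprime Y M∣AY-b′ p prime-p p∣q p^s∣Y =
      prime⇒≢1 prime-p (∣1⇒≡1 (*-cancelˡ-∣ d (subst (d * p ∣_) (trans (sym d≡L₂) (sym (*-identityʳ d))) dp∣L₂)))
      where
      [dp]^s≡Dp^s : (d * p) ^ s ≡ D * p ^ s
      [dp]^s≡Dp^s = ^-distribʳ-* d p s
      [dp]^s∣AY : (d * p) ^ s ∣ abs (A ℤ.* Y)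
      [dp]^s∣AY = subst₂ _∣_ (sym [dp]^s≡Dp^s)
        (sym (trans (ℤ.abs-* A Y) (trans (cong (_* abs Y) |A|≡Da₁^s) (*-assoc D (a₁ ^ s) (abs Y)))))
        (*-monoʳ-∣ D (∣n⇒∣m*n (a₁ ^ s) p^s∣Y))
      [dp]^s∣M : (d * p) ^ s ∣ M
      [dp]^s∣M = ^-monoˡ-∣ s (subst (d * p ∣_) (sym m≡dq) (*-monoʳ-∣ d p∣q))
      dp∣L₂ : d * p ∣ G₂.L
      dp∣L₂ = G₂.L-greatest (d * p)
        (∣-difference⇒∣ʳ ((d * p) ^ s) (A ℤ.* Y) b′ [dp]^s∣AY (∣-trans [dp]^s∣M M∣AY-b′)) [dp]^s∣M

    isSievePrime? : Decidable (λ p → Prime p × (p ∣ d × ¬ p ∣ _/_ n (d * t) {{m*n≢0 d t}}))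
    isSievePrime? p = prime? p ×-dec ((p ∣? d) ×-dec ¬? (p ∣? _/_ n (d * t) {{m*n≢0 d t}}))

    sievePrimes : List ℕ
    sievePrimes = filter isSievePrime? (upTo (suc d))

    sievePrime-props : All (λ p → Prime p × (p ∣ d × ¬ p ∣ _/_ n (d * t) {{m*n≢0 d t}})) sievePrimes
    sievePrime-props = all-filter isSievePrime? (upTo (suc d))

    -- On the reduced congruence, s-power-coprimality to m only concerns the sieve primes:
    -- a prime p ∣ m = d·q either divides q (handled by reduced⇒q-powerCoprime) or is sieved.
    powerCoprime⇒survives : ∀ y → PowerCoprime y → SurvivesSieve s sievePrimes y
    powerCoprime⇒survives y coprime =
      All.map (λ (prime-p , p∣d , _) → coprime _ prime-p (∣-trans p∣d (subst (d ∣_) (sym m≡dq) (m∣m*n q)))) sievePrime-props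

    survives⇒powerCoprime : ∀ y → (+ M) ℤ∣.∣ (A ℤ.* + y ℤ.- b′) → SurvivesSieve s sievePrimes y → PowerCoprime y
    survives⇒powerCoprime y M∣ survives p prime-p p∣m with p ∣? _/_ n (d * t) {{m*n≢0 d t}}
    ... | yes p∣q = reduced⇒q-powerCoprime (+ y) M∣ p prime-p (subst (p ∣_) n/dt≡q p∣q)
    ... | no p∤q with euclidsLemma d q prime-p (subst (p ∣_) m≡dq p∣m)
    ...   | inj₂ p∣q = ⊥-elim (p∤q (subst (p ∣_) (sym n/dt≡q) p∣q))
    ...   | inj₁ p∣d = All.lookup survives (∈-filter⁺ isSievePrime? (∈-upTo⁺ (s≤s (∣⇒≤ p∣d))) (prime-p , p∣d , p∤q))

    solution⇔ : ∀ y → IsSol s a b n t (+ (T * y)) ⇔ ((+ K) ℤ∣.∣ (+ y ℤ.- y₀) × SurvivesSieve s sievePrimes y)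
    solution⇔ y = mk⇔
      (λ (N∣ , restricted) → Equivalence.to (reduced⇔class (+ y)) (Equivalence.to reduce N∣)
                            , powerCoprime⇒survives y (restriction⇒powerCoprime y restricted))
      (λ (K∣ , survives) → let M∣ = Equivalence.from (reduced⇔class (+ y)) K∣ in
         Equivalence.from reduce M∣ , powerCoprime⇒restriction y (survives⇒powerCoprime y M∣ survives))
      where
      Ty≡yT : + (T * y) ≡ + y ℤ.* + T
      Ty≡yT = trans (cong +_ (*-comm T y)) (ℤ.pos-* y T)
      reduce : ((+ N) ℤ∣.∣ (A ℤ.* + (T * y) ℤ.- b)) ⇔ ((+ M) ℤ∣.∣ (A ℤ.* + y ℤ.- b′))
      reduce = subst (λ z → ((+ N) ℤ∣.∣ (A ℤ.* z ℤ.- b)) ⇔ ((+ M) ℤ∣.∣ (A ℤ.* + y ℤ.- b′))) (sym Ty≡yT) (reduce-congruence (+ y) b′ b≡b′T)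

    numSol≡sievedClass : numSol s a b n t ≡ sievedClass s sievePrimes K y₀ D
    numSol≡sievedClass = begin
      numSol s a b n t                  ≡⟨ length-filter-upTo isSol?′ N ⟩
      count isSol?′ N                   ≡⟨ cong (count isSol?′) N≡TM ⟩
      count isSol?′ (T * M)             ≡⟨ count-multiples isSol?′ T (λ x (_ , restricted) → restriction⇒T∣x (+ x) restricted) M ⟩
      count (λ y → isSol?′ (T * y)) M   ≡⟨ cong (count (λ y → isSol?′ (T * y))) (trans M≡DK (*-comm D K)) ⟩
      count (λ y → isSol?′ (T * y)) (K * D)
                                        ≡⟨ count-cong _ _ (K * D) (λ y _ → Equivalence.to (solution⇔ y)) (λ y _ → Equivalence.from (solution⇔ y)) ⟩
      sievedClass s sievePrimes K y₀ D  ∎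
      where
      isSol?′ = λ x → isSol? s a b n t (+ x)

    sievePrimes-prime : All Prime sievePrimes
    sievePrimes-prime = All.map proj₁ sievePrime-props

    sievePrimes-distinct : AllPairs _≢_ sievePrimes
    sievePrimes-distinct = Unique.filter⁺ isSievePrime? (Unique.upTo⁺ (suc d))

    sievePrimes-coprime : All (λ p → Coprime p K) sievePrimes
    sievePrimes-coprime = All.map coprime-K sievePrime-props
      where
      coprime-K : ∀ {p} → Prime p × (p ∣ d × ¬ p ∣ _/_ n (d * t) {{m*n≢0 d t}}) → Coprime p K
      coprime-K {p} (prime-p , _ , p∤q) = coprime-^ʳ s (prime-∤⇒coprime prime-p (λ p∣q → p∤q (subst (p ∣_) (sym n/dt≡q) p∣q)))

    sievePrimes-∣ : product sievePrimes ^ s ∣ D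
    sievePrimes-∣ = ^-monoˡ-∣ s (product-∣ sievePrimes sievePrimes-prime sievePrimes-distinct
                                   (All.map (λ (_ , p∣d , _) → p∣d) sievePrime-props))

    count-formula : ι (numSol s a b n t) ≡ ι D ℚ.* factorProduct s sievePrimes
    count-formula = trans (cong ι numSol≡sievedClass)
      (sieve s sievePrimes K y₀ D sievePrimes-prime sievePrimes-distinct sievePrimes-coprime sievePrimes-∣)

    private
      q′ = _/_ n (d * t) {{m*n≢0 d t}}

      primeDivisor? : ∀ k → Decidable (λ p → Prime p × p ∣ k)
      primeDivisor? k p = prime? p ×-dec (p ∣? k)

      instance
        q′≢0 : NonZero q′
        q′≢0 = subst NonZero (sym n/dt≡q) q≢0

      d∣m : d ∣ m
      d∣m = subst (d ∣_) (sym m≡dq) (m∣m*n q)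

      q′∣m : q′ ∣ m
      q′∣m = subst (_∣ m) (sym n/dt≡q) (subst (q ∣_) (sym m≡dq) (n∣m*n d))

      filter-upTo-divisor : ∀ {P : ℕ → Set} (P? : Decidable P) k .{{_ : NonZero k}} → k ∣ m →
                            (∀ p → P p → p ∣ k) → filter P? (upTo (suc m)) ≡ filter P? (upTo (suc k))
      filter-upTo-divisor P? k k∣m witnesses∣k =
        trans (cong (λ z → filter P? (upTo (suc z))) (sym (m+[n∸m]≡n (∣⇒≤ k∣m))))
              (filter-upTo-beyond P? (suc k) (m ℕ.∸ k) (λ p Pp → s≤s (∣⇒≤ (witnesses∣k p Pp))))

      prime-∤q′ : filter (λ p → primeDivisor? m p ×-dec ¬? (p ∣? q′)) (upTo (suc m)) ≡ sievePrimes
      prime-∤q′ = trans (List.filter-≐ (λ p → primeDivisor? m p ×-dec ¬? (p ∣? q′)) isSievePrime? (to , from) (upTo (suc m)))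
                        (filter-upTo-divisor isSievePrime? d d∣m (λ _ (_ , p∣d , _) → p∣d))
        where
        to : ∀ {p} → (Prime p × p ∣ m) × ¬ p ∣ q′ → Prime p × (p ∣ d × ¬ p ∣ q′)
        to {p} ((prime-p , p∣m) , p∤q′) with euclidsLemma d q prime-p (subst (p ∣_) m≡dq p∣m)
        ... | inj₁ p∣d = prime-p , p∣d , p∤q′
        ... | inj₂ p∣q = ⊥-elim (p∤q′ (subst (p ∣_) (sym n/dt≡q) p∣q))
        from : ∀ {p} → Prime p × (p ∣ d × ¬ p ∣ q′) → (Prime p × p ∣ m) × ¬ p ∣ q′
        from (prime-p , p∣d , p∤q′) = (prime-p , ∣-trans p∣d d∣m) , p∤q′

      prime-∣q′ : filter (λ p → primeDivisor? m p ×-dec (p ∣? q′)) (upTo (suc m)) ≡ filter (primeDivisor? q′) (upTo (suc q′))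
      prime-∣q′ = trans (List.filter-≐ (λ p → primeDivisor? m p ×-dec (p ∣? q′)) (primeDivisor? q′) (to , from) (upTo (suc m)))
                        (filter-upTo-divisor (primeDivisor? q′) q′ q′∣m (λ _ → proj₂))
        where
        to : ∀ {p} → (Prime p × p ∣ m) × p ∣ q′ → Prime p × p ∣ q′
        to ((prime-p , _) , p∣q′) = prime-p , p∣q′
        from : ∀ {p} → Prime p × p ∣ q′ → (Prime p × p ∣ m) × p ∣ q′
        from (prime-p , p∣q′) = (prime-p , ∣-trans p∣q′ q′∣m) , p∣q′

    jordan-formula : ι (numSol s a b n t) ℚ.* J s q′ ≡ J s m
    jordan-formula = begin
      ι (numSol s a b n t) ℚ.* (ι (q′ ^ s) ℚ.* Π∣q′)                  ≡⟨ cong (ℚ._* (ι (q′ ^ s) ℚ.* Π∣q′)) count-formula ⟩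
      ι D ℚ.* Πsieve ℚ.* (ι (q′ ^ s) ℚ.* Π∣q′)                        ≡⟨ interchange (ι D) Πsieve (ι (q′ ^ s)) Π∣q′ ⟩
      (ι D ℚ.* ι (q′ ^ s)) ℚ.* (Πsieve ℚ.* Π∣q′)                      ≡⟨ cong₂ ℚ._*_ (sym (ι-* D (q′ ^ s)))
                                                                          (sym (cong₂ ℚ._*_ (cong (factorProduct s) prime-∤q′) (cong (factorProduct s) prime-∣q′))) ⟩
      ι (D * q′ ^ s) ℚ.* (factorProduct s (filter (λ p → primeDivisor? m p ×-dec ¬? (p ∣? q′)) (upTo (suc m)))
                          ℚ.* factorProduct s (filter (λ p → primeDivisor? m p ×-dec (p ∣? q′)) (upTo (suc m))))
                                                                       ≡⟨ cong₂ ℚ._*_ (cong ι (sym (trans M≡DK (cong (λ z → D * z ^ s) (sym n/dt≡q)))))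
                                                                                      (sym (factorProduct-split s (primeDivisor? m) (_∣? q′) (upTo (suc m)))) ⟩
      ι (m ^ s) ℚ.* factorProduct s (filter (primeDivisor? m) (upTo (suc m))) ∎
      where
      Πsieve = factorProduct s sievePrimes
      Π∣q′ = factorProduct s (filter (primeDivisor? q′) (upTo (suc q′)))
      interchange : ∀ a b c e → a ℚ.* b ℚ.* (c ℚ.* e) ≡ (a ℚ.* c) ℚ.* (b ℚ.* e)
      interchange = solve 4 (λ a b c e → a :* b :* (c :* e) := (a :* c) :* (b :* e)) refl

  -- Sufficiency: with d^s = (A, M)_s the count d^s·∏(1 - p^{-s}) is positive.
  sufficient : Conditions → ∃[ x ] IsSol s a b n t x
  sufficient (T∣gcd , gcds) = first (filter isSol?′ (upTo N)) (all-filter isSol?′ (upTo N)) numSol≢0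
    where
    isSol?′ = λ x → isSol? s a b n t (+ x)
    instance
      N/T≢0 : NonZero (N / T)
      N/T≢0 = subst NonZero (sym N/T≡M) M≢0
    module G = GcdWith (N / T) A
    instance
      L≢0 : NonZero G.L
      L≢0 = G.L≢0
    open SolutionCount T∣gcd gcds G.L refl
    numSol≢0 : numSol s a b n t ≢ 0
    numSol≢0 numSol≡0 = ℚ.<-irrefl (trans (cong ι (sym numSol≡0)) count-formula)
      (ℚ.positive⁻¹ _ {{ℚ.pos*pos⇒pos (ι D) {{ι-positive D}} (factorProduct s sievePrimes)
                                       {{factorProduct-positive s sievePrimes sievePrimes-prime}}}})
    first : ∀ xs → All (λ x → IsSol s a b n t (+ x)) xs → length xs ≢ 0 → ∃[ x ] IsSol s a b n t x
    first [] _ length≢0 = ⊥-elim (length≢0 refl)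
    first (x ∷ _) (sol ∷ _) _ = + x , sol

open import Defs
open import Data.Nat using (ℕ; NonZero; _^_; _*_; _/_)
open import Data.Nat.Divisibility using (_∣_; _∣?_)
open import Data.Nat.Properties using (m^n≢0; m*n≢0)
open import Data.Integer using (ℤ; +_; _/ℕ_)
import Data.Integer as ℤ
import Data.Rational as ℚ
open import Data.Product using (_×_; ∃-syntax; _,_)
open import Function.Bundles using (_⇔_; mk⇔)
open import Relation.Binary.PropositionalEquality using (_≡_)
open import Relation.Nullary.Decidable using (_×-dec_; ¬?)

mainTheorem1 : (a b : ℤ) (n s t : ℕ) → .{{_ : NonZero n}} → .{{_ : NonZero s}} → .{{_ : NonZero t}}
    → t ∣ n
    → ((∃[ x ] IsSol s a b n t x)
         ⇔ ((t ^ s ∣ genGcd s b (+ (n ^ s)))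
            × (genGcd s (a ℤ.^ s) (+ (_/_ (n ^ s) (t ^ s) {{m^n≢0 t s}})) ≡ genGcd s (_/ℕ_ b (t ^ s) {{m^n≢0 t s}}) (+ (_/_ (n ^ s) (t ^ s) {{m^n≢0 t s}})))))
      × ((t ^ s ∣ genGcd s b (+ (n ^ s)))
         → (genGcd s (a ℤ.^ s) (+ (_/_ (n ^ s) (t ^ s) {{m^n≢0 t s}})) ≡ genGcd s (_/ℕ_ b (t ^ s) {{m^n≢0 t s}}) (+ (_/_ (n ^ s) (t ^ s) {{m^n≢0 t s}})))
         → (d : ℕ) → .{{_ : NonZero d}}
         → d ^ s ≡ genGcd s (a ℤ.^ s) (+ (_/_ (n ^ s) (t ^ s) {{m^n≢0 t s}}))
         → ((+ numSol s a b n t ℚ./ 1)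
              ≡ (+ (d ^ s) ℚ./ 1) ℚ.* primeProd s (λ p → (p ∣? d) ×-dec ¬? (p ∣? (_/_ n (d * t) {{m*n≢0 d t}}))) d)
           × ((+ numSol s a b n t ℚ./ 1) ℚ.* J s (_/_ n (d * t) {{m*n≢0 d t}}) ≡ J s (n / t)))
mainTheorem1 a b n s t t∣n =
  mk⇔ (λ (x , sol) → necessary x sol) sufficient ,
  λ T∣gcd gcds d d^s≡ → let open SolutionCount T∣gcd gcds d d^s≡ in count-formula , jordan-formula
  where open RestrictedCongruence a b n s t t∣n
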